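{- Let the numbers $\gamma_{n,i,j}$ ($n,i,j\geqslant 0$) be defined by $\gamma_{0,0,0}=1$, $\gamma_{0,i,j}=0$ for $(i,j)\neq(0,0)$, $\gamma_{n,i,j}=0$ whenever an index is negative, and $$\gamma_{n+1,i,j}=\gamma_{n,i-1,j}+(1+i)\gamma_{n,i+1,j-1}+j\gamma_{n,i,j}+(n-i-2j+2)\gamma_{n,i,j-1}.$$ Let $\gamma_n(x,y)=\sum_{i=0}^n\sum_{j=0}^{\lfloor (n-i)/2\rfloor}\gamma_{n,i,j}x^iy^j$ and $\gamma(x,y;z)=\sum_{n\geqslant 0}\gamma_n(x,y)\frac{z^n}{n!}$. Then $$\gamma(x,y;z)=\mathrm{e}^{z(x-1)}\left(\frac{\sqrt{2y-1}\,\sec\left(\frac{z}{2}\sqrt{2y-1}\right)}{\sqrt{2y-1}-\tan\left(\frac{z}{2}\sqrt{2y-1}\right)}\right)^2.$$ -}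

module Defs where

open import Data.Nat as ℕ using (ℕ; zero; suc; _!; _≤ᵇ_; _∸_)
open import Data.Nat.Properties using (_!≢0)
open import Data.Integer as ℤ using (ℤ; +_)
open import Data.Rational as ℚ using (ℚ; 0ℚ; 1ℚ; _+_; _*_; _-_; -_)
open import Data.Bool using (if_then_else_; _∧_)

-- The numbers γ_{n,i,j}  (indices in ℕ; a term whose index would be
-- negative is 0, as in the paper)

γ : ℕ → ℕ → ℕ → ℤ
γ zero zero zero = ℤ.+ 1
γ zero _    _    = ℤ.+ 0
γ (suc n) i j = term₁ i ℤ.+ term₂ j ℤ.+ (+ j) ℤ.* γ n i j ℤ.+ term₄ j
  where
  term₁ : ℕ → ℤ
  term₁ zero    = + 0
  term₁ (suc i′) = γ n i′ j
  term₂ : ℕ → ℤ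
  term₂ zero     = + 0
  term₂ (suc j′) = (+ (suc i)) ℤ.* γ n (suc i) j′
  term₄ : ℕ → ℤ
  term₄ zero     = + 0
  term₄ (suc j′) = ((+ n) ℤ.- (+ i) ℤ.- (+ (2 ℕ.* j)) ℤ.+ (+ 2)) ℤ.* γ n i j′

-- Formal power series in x, y, z over ℚ, as coefficient functions:
-- F n i j  is the coefficient of  z^n x^i y^j.

Series : Set
Series = ℕ → ℕ → ℕ → ℚ

sumTo : ℕ → (ℕ → ℚ) → ℚ
sumTo zero    f = f 0
sumTo (suc n) f = sumTo n f + f (suc n)

fromℕ : ℕ → ℚ
fromℕ m = (+ m) ℚ./ 1

invFact : ℕ → ℚ
invFact m = (+ 1) ℚ./ (m !) where instance _ = m !≢0

infixl 6 _⊕_ _⊖_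
infixl 7 _⊛_

_⊕_ : Series → Series → Series
(F ⊕ G) n i j = F n i j + G n i j

_⊖_ : Series → Series → Series
(F ⊖ G) n i j = F n i j - G n i j

_⊛_ : Series → Series → Series
(F ⊛ G) n i j =
  sumTo n λ a → sumTo i λ b → sumTo j λ c →
    F a b c * G (n ∸ a) (i ∸ b) (j ∸ c)

scale : ℚ → Series → Series
scale q F n i j = q * F n i j

one X Y Z : Series
one zero zero zero = 1ℚ
one _    _    _    = 0ℚ
X zero (suc zero) zero = 1ℚ
X _    _          _    = 0ℚ
Y zero zero (suc zero) = 1ℚ
Y _    _    _          = 0ℚ
Z (suc zero) zero zero = 1ℚ
Z _          _    _    = 0ℚ

pow : Series → ℕ → Series
pow F zero    = one
pow F (suc m) = F ⊛ pow F m

-- Substitution of a series W with zero constant term in z (z-order ≥ 1)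
-- into the one-variable power series  Σ_k a_k t^k :  Σ_k a_k W^k.
-- Since W^k has z-order ≥ k, the coefficient of z^n only needs k ≤ n.
subst : (ℕ → ℚ) → Series → Series
subst a W n i j = sumTo n λ k → a k * pow W k n i j

-- 1/(1 - T) = Σ_k T^k   for T of z-order ≥ 1
geom : Series → Series
geom = subst (λ _ → 1ℚ)

sign : ℕ → ℚ
sign zero    = 1ℚ
sign (suc k) = - sign k

gammaGF : Series
gammaGF n i j =
  if (i ≤ᵇ n) ∧ (2 ℕ.* j ≤ᵇ n ∸ i)
  then ((γ n i j) ℚ./ 1) * invFact n
  else 0ℚ

-- Right-hand side.  Put a = √(2y-1) and w = (z/2) a, so that
-- w² = z² (2y-1)/4 lies in ℚ[y][[z]].

w² : Series
w² = scale (1ℚ ℚ.÷ fromℕ 4) (Z ⊛ Z ⊛ (scale (fromℕ 2) Y ⊖ one))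

cosW : Series
cosW = subst (λ k → sign k * invFact (2 ℕ.* k)) w²

-- sin w / a = (z/2) Σ_k (-1)^k w^{2k} / (2k+1)!
sinWoverA : Series
sinWoverA = scale (1ℚ ℚ.÷ fromℕ 2) Z ⊛ subst (λ k → sign k * invFact (suc (2 ℕ.* k))) w²

-- sec w = 1 / cos w = 1 / (1 - (1 - cos w))
secW : Series
secW = geom (one ⊖ cosW)

tanWoverA : Series
tanWoverA = sinWoverA ⊛ secW

-- a sec w / (a - tan w) = sec w / (1 - tan w / a)
ratio : Series
ratio = secW ⊛ geom tanWoverA

expZX : Series
expZX = subst invFact (Z ⊛ (X ⊖ one))

rhs : Series
rhs = expZX ⊛ (ratio ⊛ ratio)

module Submission where

-- Put a = √(2y - 1), w = (z/2) a and Q = cos w - (sin w)/a, a power series in z over ℚ[y].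
-- The recurrence for γ says exactly that Γ = Σ γ_n(x, y) z^n/n! satisfies 𝒟 Γ = x Γ for the
-- derivation 𝒟 = (1 - yz) ∂z - y(1 - x) ∂x - y(1 - 2y) ∂y, while 𝒟 Q = -Q/2 and
-- 𝒟 e^{z(x-1)} = (x - 1) e^{z(x-1)}. Hence Γ Q² and e^{z(x-1)} both solve 𝒟 F = (x - 1) F with
-- F = 1 at z = 0, and this initial value problem has only one solution because the z^n part of
-- the equation determines the z^{n+1} part of F. Since a sec w/(a - tan w) = 1/Q, the right-hand
-- side is e^{z(x-1)}/Q², which is Γ.

open import Defs
open import Algebra.Bundles using (CommutativeRing)
open import Algebra.Structures using (IsCommutativeRing)
import Algebra.Solver.Ring as RingSolver
import Algebra.Solver.Ring.AlmostCommutativeRing as ACR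
open import Data.Bool using (true; false)
open import Data.Integer as ℤ using (ℤ)
import Data.Integer.Properties as ℤP
import Data.Integer.Solver as ℤ-Solver
open import Data.Maybe using (Maybe; just; nothing)
open import Data.Nat as ℕ using (ℕ; zero; suc; _∸_; _≤_; _<_; z≤n; s≤s; _≤ᵇ_; _!)
import Data.Nat.Properties as ℕP
open import Data.Product using (_,_)
open import Data.Rational as ℚ using (ℚ; 0ℚ; 1ℚ; _+_; _*_; _-_; -_; fromℚᵘ)
import Data.Rational.Properties as ℚP
import Data.Rational.Solver as ℚ-Solver
import Data.Rational.Unnormalised as ℚᵘ
import Data.Rational.Unnormalised.Properties as ℚᵘP
open import Data.Sum using (inj₁; inj₂)
open import Relation.Binary.PropositionalEquality hiding (subst)
import Relation.Binary.PropositionalEquality as ≡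
open import Relation.Binary.Structures using (IsEquivalence)
import Relation.Binary.Reasoning.Setoid as SetoidReasoning
open import Relation.Nullary using (yes; no)
open import Relation.Nullary.Reflects using (ofʸ; ofⁿ)

sumTo-cong≤ : ∀ n {f g : ℕ → ℚ} → (∀ k → k ≤ n → f k ≡ g k) → sumTo n f ≡ sumTo n g
sumTo-cong≤ zero    f≗g = f≗g 0 z≤n
sumTo-cong≤ (suc n) f≗g =
  cong₂ _+_ (sumTo-cong≤ n (λ k k≤n → f≗g k (ℕP.m≤n⇒m≤1+n k≤n))) (f≗g (suc n) ℕP.≤-refl)

sumTo-cong : ∀ n {f g : ℕ → ℚ} → (∀ k → f k ≡ g k) → sumTo n f ≡ sumTo n g
sumTo-cong n f≗g = sumTo-cong≤ n (λ k _ → f≗g k)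

sumTo-zero : ∀ n {f : ℕ → ℚ} → (∀ k → k ≤ n → f k ≡ 0ℚ) → sumTo n f ≡ 0ℚ
sumTo-zero zero    f≗0 = f≗0 0 z≤n
sumTo-zero (suc n) f≗0 =
  cong₂ _+_ (sumTo-zero n (λ k k≤n → f≗0 k (ℕP.m≤n⇒m≤1+n k≤n))) (f≗0 (suc n) ℕP.≤-refl)

sumTo-+ : ∀ n (f g : ℕ → ℚ) → sumTo n (λ k → f k + g k) ≡ sumTo n f + sumTo n g
sumTo-+ zero    f g = refl
sumTo-+ (suc n) f g =
  trans (cong (_+ (f (suc n) + g (suc n))) (sumTo-+ n f g))
        (+-interchange (sumTo n f) (sumTo n g) (f (suc n)) (g (suc n)))
  where
  +-interchange : ∀ a b c d → (a + b) + (c + d) ≡ (a + c) + (b + d)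
  +-interchange = ℚ-Solver.+-*-Solver.solve 4
    (λ a b c d → (a :+ b) :+ (c :+ d) := (a :+ c) :+ (b :+ d)) refl
    where open ℚ-Solver.+-*-Solver

sumTo-*ˡ : ∀ n c (f : ℕ → ℚ) → c * sumTo n f ≡ sumTo n (λ k → c * f k)
sumTo-*ˡ zero    c f = refl
sumTo-*ˡ (suc n) c f = trans (ℚP.*-distribˡ-+ c _ _) (cong (_+ (c * f (suc n))) (sumTo-*ˡ n c f))

sumTo-*ʳ : ∀ n c (f : ℕ → ℚ) → sumTo n f * c ≡ sumTo n (λ k → f k * c)
sumTo-*ʳ n c f =
  trans (ℚP.*-comm _ c) (trans (sumTo-*ˡ n c f) (sumTo-cong n (λ k → ℚP.*-comm c (f k))))

sumTo-neg : ∀ n (f : ℕ → ℚ) → sumTo n (λ k → - f k) ≡ - sumTo n f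
sumTo-neg zero    f = refl
sumTo-neg (suc n) f =
  trans (cong (_+ (- f (suc n))) (sumTo-neg n f)) (sym (ℚP.neg-distrib-+ (sumTo n f) (f (suc n))))

sumTo-swap : ∀ n m (f : ℕ → ℕ → ℚ) →
  sumTo n (λ a → sumTo m (λ b → f a b)) ≡ sumTo m (λ b → sumTo n (λ a → f a b))
sumTo-swap zero    m f = refl
sumTo-swap (suc n) m f =
  trans (cong (_+ sumTo m (λ b → f (suc n) b)) (sumTo-swap n m f))
        (sym (sumTo-+ m (λ b → sumTo n (λ a → f a b)) (λ b → f (suc n) b)))

sumTo-head : ∀ n (f : ℕ → ℚ) → sumTo (suc n) f ≡ f 0 + sumTo n (λ k → f (suc k))
sumTo-head zero    f = refl
sumTo-head (suc n) f =
  trans (cong (_+ f (suc (suc n))) (sumTo-head n f))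
        (ℚP.+-assoc (f 0) (sumTo n (λ k → f (suc k))) (f (suc (suc n))))

sumTo-onlyHead : ∀ n (f : ℕ → ℚ) → (∀ k → f (suc k) ≡ 0ℚ) → sumTo n f ≡ f 0
sumTo-onlyHead zero    f f≗0 = refl
sumTo-onlyHead (suc n) f f≗0 =
  trans (sumTo-head n f)
        (trans (cong (f 0 +_) (sumTo-zero n (λ k _ → f≗0 k))) (ℚP.+-identityʳ _))

sumTo-lastZero : ∀ n (f : ℕ → ℚ) → f (suc n) ≡ 0ℚ → sumTo (suc n) f ≡ sumTo n f
sumTo-lastZero n f f₀ = trans (cong (sumTo n f +_) f₀) (ℚP.+-identityʳ _)

sumTo-extend : ∀ {n N} (f : ℕ → ℚ) → n ≤ N → (∀ k → n < k → f k ≡ 0ℚ) → sumTo N f ≡ sumTo n f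
sumTo-extend {n} f n≤N tail≗0 =
  trans (cong (λ t → sumTo t f) (sym (ℕP.m∸n+n≡m n≤N))) (extend (_ ∸ n))
  where
  extend : ∀ d → sumTo (d ℕ.+ n) f ≡ sumTo n f
  extend zero    = refl
  extend (suc d) =
    trans (sumTo-lastZero (d ℕ.+ n) f (tail≗0 _ (s≤s (ℕP.m≤n+m n d)))) (extend d)

sumTo-reverse : ∀ n (f : ℕ → ℚ) → sumTo n f ≡ sumTo n (λ k → f (n ∸ k))
sumTo-reverse zero    f = refl
sumTo-reverse (suc n) f =
  trans (ℚP.+-comm (sumTo n f) (f (suc n)))
        (trans (cong (f (suc n) +_) (sumTo-reverse n f)) (sym (sumTo-head n (λ k → f (suc n ∸ k)))))

sumTo-reflect : ∀ n (h : ℕ → ℕ → ℚ) → sumTo n (λ a → h a (n ∸ a)) ≡ sumTo n (λ a → h (n ∸ a) a)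
sumTo-reflect n h = trans (sumTo-reverse n (λ a → h a (n ∸ a)))
  (sumTo-cong≤ n (λ a a≤n → cong (h (n ∸ a)) (ℕP.m∸[m∸n]≡n a≤n)))

-- Both sides sum φ over the triples (c, d, e) with c + d + e = n.
sumTo-triangle : ∀ n (φ : ℕ → ℕ → ℕ → ℚ) →
  sumTo n (λ a → sumTo a (λ c → φ c (a ∸ c) (n ∸ a))) ≡
  sumTo n (λ c → sumTo (n ∸ c) (λ d → φ c d (n ∸ c ∸ d)))
sumTo-triangle zero    φ = refl
sumTo-triangle (suc n) φ = begin
    sumTo n (λ a → sumTo a (λ c → φ c (a ∸ c) (suc n ∸ a))) + sumTo (suc n) (λ c → φ c (suc n ∸ c) (n ∸ n))
  ≡⟨ cong₂ _+_ inner-triangle diagonal ⟩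
    sumTo n (λ c → sumTo (n ∸ c) (λ d → φ c d (suc (n ∸ c ∸ d))))
      + (sumTo n (λ c → φ c (suc n ∸ c) 0) + φ (suc n) 0 0)
  ≡⟨ sym (ℚP.+-assoc (sumTo n (λ c → sumTo (n ∸ c) (λ d → φ c d (suc (n ∸ c ∸ d)))))
                      (sumTo n (λ c → φ c (suc n ∸ c) 0)) (φ (suc n) 0 0)) ⟩
    sumTo n (λ c → sumTo (n ∸ c) (λ d → φ c d (suc (n ∸ c ∸ d)))) + sumTo n (λ c → φ c (suc n ∸ c) 0)
      + φ (suc n) 0 0
  ≡⟨ cong (_+ φ (suc n) 0 0) (trans (sym (sumTo-+ n _ _)) (sumTo-cong≤ n append-last)) ⟩
    sumTo n (λ c → sumTo (suc n ∸ c) (λ d → φ c d (suc n ∸ c ∸ d))) + φ (suc n) 0 0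
  ≡⟨ cong (λ m → sumTo n (λ c → sumTo (suc n ∸ c) (λ d → φ c d (suc n ∸ c ∸ d)))
                   + sumTo m (λ d → φ (suc n) d (m ∸ d))) (sym (ℕP.n∸n≡0 n)) ⟩
    sumTo n (λ c → sumTo (suc n ∸ c) (λ d → φ c d (suc n ∸ c ∸ d)))
      + sumTo (n ∸ n) (λ d → φ (suc n) d (n ∸ n ∸ d))
  ∎
  where
  open ≡-Reasoning
  inner-triangle : sumTo n (λ a → sumTo a (λ c → φ c (a ∸ c) (suc n ∸ a)))
                 ≡ sumTo n (λ c → sumTo (n ∸ c) (λ d → φ c d (suc (n ∸ c ∸ d))))
  inner-triangle =
    trans (sumTo-cong≤ n (λ a a≤n → sumTo-cong a (λ c → cong (φ c (a ∸ c)) (ℕP.+-∸-assoc 1 a≤n))))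
          (sumTo-triangle n (λ c d e → φ c d (suc e)))
  diagonal : sumTo (suc n) (λ c → φ c (suc n ∸ c) (n ∸ n))
           ≡ sumTo n (λ c → φ c (suc n ∸ c) 0) + φ (suc n) 0 0
  diagonal = cong₂ _+_ (sumTo-cong n (λ c → cong (φ c (suc n ∸ c)) (ℕP.n∸n≡0 n)))
                       (cong₂ (φ (suc n)) (ℕP.n∸n≡0 n) (ℕP.n∸n≡0 n))
  append-last : ∀ c → c ≤ n →
    sumTo (n ∸ c) (λ d → φ c d (suc (n ∸ c ∸ d))) + φ c (suc n ∸ c) 0
      ≡ sumTo (suc n ∸ c) (λ d → φ c d (suc n ∸ c ∸ d))
  append-last c c≤n rewrite ℕP.+-∸-assoc 1 c≤n =
    cong₂ _+_ (sumTo-cong≤ (n ∸ c) (λ d d≤ → cong (φ c d) (sym (ℕP.+-∸-assoc 1 d≤))))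
              (cong (φ c (suc (n ∸ c))) (sym (ℕP.n∸n≡0 (n ∸ c))))

Σ² : ℕ → ℕ → (ℕ → ℕ → ℚ) → ℚ
Σ² i j f = sumTo i λ b → sumTo j λ c → f b c

Σ³ : ℕ → ℕ → ℕ → (ℕ → ℕ → ℕ → ℚ) → ℚ
Σ³ n i j f = sumTo n λ a → Σ² i j (f a)

Σ²-zero : ∀ i j {f : ℕ → ℕ → ℚ} → (∀ b c → f b c ≡ 0ℚ) → Σ² i j f ≡ 0ℚ
Σ²-zero i j f≗0 = sumTo-zero i λ b _ → sumTo-zero j λ c _ → f≗0 b c

Σ²-*ˡ : ∀ i j q f → q * Σ² i j f ≡ Σ² i j (λ b c → q * f b c)
Σ²-*ˡ i j q f = trans (sumTo-*ˡ i q _) (sumTo-cong i λ b → sumTo-*ˡ j q _)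

Σ³-*ˡ : ∀ n i j q f → q * Σ³ n i j f ≡ Σ³ n i j (λ a b c → q * f a b c)
Σ³-*ˡ n i j q f = trans (sumTo-*ˡ n q _) (sumTo-cong n λ a → Σ²-*ˡ i j q _)

Σ³-*ʳ : ∀ n i j q f → Σ³ n i j f * q ≡ Σ³ n i j (λ a b c → f a b c * q)
Σ³-*ʳ n i j q f =
  trans (sumTo-*ʳ n q _) (sumTo-cong n λ a → trans (sumTo-*ʳ i q _) (sumTo-cong i λ b → sumTo-*ʳ j q _))

Σ³-neg : ∀ n i j f → Σ³ n i j (λ a b c → - f a b c) ≡ - Σ³ n i j f
Σ³-neg n i j f =
  trans (sumTo-cong n λ a → trans (sumTo-cong i λ b → sumTo-neg j _) (sumTo-neg i _)) (sumTo-neg n _)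

-- The ring of formal power series

infix 4 _≈_
_≈_ : Series → Series → Set
F ≈ G = ∀ n i j → F n i j ≡ G n i j

≈-refl : ∀ {F} → F ≈ F
≈-refl n i j = refl

≈-sym : ∀ {F G} → F ≈ G → G ≈ F
≈-sym F≈G n i j = sym (F≈G n i j)

≈-trans : ∀ {F G H} → F ≈ G → G ≈ H → F ≈ H
≈-trans F≈G G≈H n i j = trans (F≈G n i j) (G≈H n i j)

zeroS : Series
zeroS _ _ _ = 0ℚ

negS : Series → Series
negS F n i j = - F n i j

⊕-cong : ∀ {F F′ G G′} → F ≈ F′ → G ≈ G′ → F ⊕ G ≈ F′ ⊕ G′
⊕-cong F≈F′ G≈G′ n i j = cong₂ _+_ (F≈F′ n i j) (G≈G′ n i j)

⊖-cong : ∀ {F F′ G G′} → F ≈ F′ → G ≈ G′ → F ⊖ G ≈ F′ ⊖ G′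
⊖-cong F≈F′ G≈G′ n i j = cong₂ _-_ (F≈F′ n i j) (G≈G′ n i j)

⊛-cong : ∀ {F F′ G G′} → F ≈ F′ → G ≈ G′ → F ⊛ G ≈ F′ ⊛ G′
⊛-cong F≈F′ G≈G′ n i j = sumTo-cong n λ a → sumTo-cong i λ b → sumTo-cong j λ c →
  cong₂ _*_ (F≈F′ a b c) (G≈G′ (n ∸ a) (i ∸ b) (j ∸ c))

⊛-comm : ∀ F G → F ⊛ G ≈ G ⊛ F
⊛-comm F G n i j =
  trans (sumTo-reflect n (λ a a′ → Σ² i j λ b c → F a b c * G a′ (i ∸ b) (j ∸ c)))
  (sumTo-cong n λ a → trans (sumTo-reflect i (λ b b′ → sumTo j λ c → F (n ∸ a) b c * G a b′ (j ∸ c)))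
  (sumTo-cong i λ b → trans (sumTo-reflect j (λ c c′ → F (n ∸ a) (i ∸ b) c * G a b c′))
  (sumTo-cong j λ c → ℚP.*-comm (F (n ∸ a) (i ∸ b) (j ∸ c)) (G a b c))))

⊛-distribˡ : ∀ F G H → F ⊛ (G ⊕ H) ≈ (F ⊛ G) ⊕ (F ⊛ H)
⊛-distribˡ F G H n i j =
  trans (sumTo-cong n λ a → trans (sumTo-cong i λ b → trans (sumTo-cong j λ c →
    ℚP.*-distribˡ-+ (F a b c) _ _) (sumTo-+ j _ _)) (sumTo-+ i _ _)) (sumTo-+ n _ _)

⊛-distribʳ : ∀ F G H → (G ⊕ H) ⊛ F ≈ (G ⊛ F) ⊕ (H ⊛ F)
⊛-distribʳ F G H n i j = trans (⊛-comm (G ⊕ H) F n i j) (trans (⊛-distribˡ F G H n i j)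
  (cong₂ _+_ (⊛-comm F G n i j) (⊛-comm F H n i j)))

⊛-assoc : ∀ F G H → (F ⊛ G) ⊛ H ≈ F ⊛ (G ⊛ H)
⊛-assoc F G H n i j = begin
    Σ³ n i j (λ a b c → (F ⊛ G) a b c * H (n ∸ a) (i ∸ b) (j ∸ c))
  ≡⟨ sumTo-cong n (λ a → sumTo-cong i λ b → sumTo-cong j λ c →
       trans (Σ³-*ʳ a b c (H (n ∸ a) (i ∸ b) (j ∸ c)) _)
         (sumTo-cong a λ a′ → sumTo-cong b λ b′ → sumTo-cong c λ c′ →
           ℚP.*-assoc (F a′ b′ c′) (G (a ∸ a′) (b ∸ b′) (c ∸ c′)) (H (n ∸ a) (i ∸ b) (j ∸ c)))) ⟩
    sumTo n (λ a → sumTo i λ b → sumTo j λ c → sumTo a λ a′ → sumTo b λ b′ → sumTo c λ c′ →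
      F a′ b′ c′ * (G (a ∸ a′) (b ∸ b′) (c ∸ c′) * H (n ∸ a) (i ∸ b) (j ∸ c)))
  ≡⟨ sumTo-cong n (λ a → trans (sumTo-cong i λ b → trans (sumTo-swap j a _)
        (sumTo-cong a λ a′ → sumTo-swap j b _)) (sumTo-swap i a _)) ⟩
    sumTo n (λ a → sumTo a λ a′ → sumTo i λ b → sumTo b λ b′ → sumTo j λ c → sumTo c λ c′ →
      F a′ b′ c′ * (G (a ∸ a′) (b ∸ b′) (c ∸ c′) * H (n ∸ a) (i ∸ b) (j ∸ c)))
  ≡⟨ sumTo-triangle n (λ a′ d e → sumTo i λ b → sumTo b λ b′ → sumTo j λ c → sumTo c λ c′ →
      F a′ b′ c′ * (G d (b ∸ b′) (c ∸ c′) * H e (i ∸ b) (j ∸ c))) ⟩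
    sumTo n (λ a′ → sumTo (n ∸ a′) λ d → sumTo i λ b → sumTo b λ b′ → sumTo j λ c → sumTo c λ c′ →
      F a′ b′ c′ * (G d (b ∸ b′) (c ∸ c′) * H (n ∸ a′ ∸ d) (i ∸ b) (j ∸ c)))
  ≡⟨ sumTo-cong n (λ a′ → sumTo-cong (n ∸ a′) λ d →
       trans (sumTo-triangle i (λ b′ e g → sumTo j λ c → sumTo c λ c′ →
                F a′ b′ c′ * (G d e (c ∸ c′) * H (n ∸ a′ ∸ d) g (j ∸ c))))
       (sumTo-cong i λ b′ → sumTo-cong (i ∸ b′) λ e →
         sumTo-triangle j (λ c′ f g → F a′ b′ c′ * (G d e f * H (n ∸ a′ ∸ d) (i ∸ b′ ∸ e) g)))) ⟩
    sumTo n (λ a′ → sumTo (n ∸ a′) λ d → sumTo i λ b′ → sumTo (i ∸ b′) λ e →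
      sumTo j λ c′ → sumTo (j ∸ c′) λ f →
      F a′ b′ c′ * (G d e f * H (n ∸ a′ ∸ d) (i ∸ b′ ∸ e) (j ∸ c′ ∸ f)))
  ≡⟨ sumTo-cong n (λ a′ → trans (sumTo-cong (n ∸ a′) λ d → sumTo-cong i λ b′ → sumTo-swap (i ∸ b′) j _)
       (trans (sumTo-swap (n ∸ a′) i _) (sumTo-cong i λ b′ → sumTo-swap (n ∸ a′) j _))) ⟩
    Σ³ n i j (λ a′ b′ c′ → Σ³ (n ∸ a′) (i ∸ b′) (j ∸ c′) λ d e f →
      F a′ b′ c′ * (G d e f * H (n ∸ a′ ∸ d) (i ∸ b′ ∸ e) (j ∸ c′ ∸ f)))
  ≡⟨ sumTo-cong n (λ a′ → sumTo-cong i λ b′ → sumTo-cong j λ c′ →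
       sym (Σ³-*ˡ (n ∸ a′) (i ∸ b′) (j ∸ c′) (F a′ b′ c′) _)) ⟩
    Σ³ n i j (λ a′ b′ c′ → F a′ b′ c′ * (G ⊛ H) (n ∸ a′) (i ∸ b′) (j ∸ c′))
  ∎
  where open ≡-Reasoning

⊛-identityˡ : ∀ F → one ⊛ F ≈ F
⊛-identityˡ F n i j =
  trans (sumTo-onlyHead n _ (λ a → Σ²-zero i j λ b c → ℚP.*-zeroˡ (F (n ∸ suc a) (i ∸ b) (j ∸ c))))
  (trans (sumTo-onlyHead i _ (λ b → sumTo-zero j λ c _ → ℚP.*-zeroˡ (F n (i ∸ suc b) (j ∸ c))))
  (trans (sumTo-onlyHead j _ (λ c → ℚP.*-zeroˡ (F n i (j ∸ suc c))))
  (ℚP.*-identityˡ (F n i j))))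

⊛-identityʳ : ∀ F → F ⊛ one ≈ F
⊛-identityʳ F = ≈-trans (⊛-comm F one) (⊛-identityˡ F)

⊛-zeroʳ : ∀ F → F ⊛ zeroS ≈ zeroS
⊛-zeroʳ F n i j = sumTo-zero n λ a _ → Σ²-zero i j λ b c → ℚP.*-zeroʳ (F a b c)

series-isCommutativeRing : IsCommutativeRing _≈_ _⊕_ _⊛_ negS zeroS one
series-isCommutativeRing = record
  { isRing = record
    { +-isAbelianGroup = record
      { isGroup = record
        { isMonoid = record
          { isSemigroup = record
            { isMagma = record { isEquivalence = ≈-isEquivalence ; ∙-cong = ⊕-cong }
            ; assoc = λ F G H n i j → ℚP.+-assoc (F n i j) (G n i j) (H n i j) }
          ; identity = (λ F n i j → ℚP.+-identityˡ (F n i j)) , (λ F n i j → ℚP.+-identityʳ (F n i j)) }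
        ; inverse = (λ F n i j → ℚP.+-inverseˡ (F n i j)) , (λ F n i j → ℚP.+-inverseʳ (F n i j))
        ; ⁻¹-cong = λ F≈G n i j → cong -_ (F≈G n i j) }
      ; comm = λ F G n i j → ℚP.+-comm (F n i j) (G n i j) }
    ; *-cong = ⊛-cong
    ; *-assoc = ⊛-assoc
    ; *-identity = ⊛-identityˡ , ⊛-identityʳ
    ; distrib = ⊛-distribˡ , ⊛-distribʳ }
  ; *-comm = ⊛-comm }
  where
  ≈-isEquivalence : IsEquivalence _≈_
  ≈-isEquivalence = record { refl = ≈-refl ; sym = ≈-sym ; trans = ≈-trans }

seriesCommutativeRing : CommutativeRing _ _
seriesCommutativeRing = record { isCommutativeRing = series-isCommutativeRing }

module ≈-Reasoning = SetoidReasoning (CommutativeRing.setoid seriesCommutativeRing)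

cst : ℚ → Series
cst q = scale q one

scale-⊛ : ∀ q F G → scale q F ⊛ G ≈ scale q (F ⊛ G)
scale-⊛ q F G n i j =
  trans (sumTo-cong n λ a → sumTo-cong i λ b → sumTo-cong j λ c → ℚP.*-assoc q _ _) (sym (Σ³-*ˡ n i j q _))

cst-⊛ : ∀ q F → cst q ⊛ F ≈ scale q F
cst-⊛ q F n i j = trans (scale-⊛ q one F n i j) (cong (q *_) (⊛-identityˡ F n i j))

cst-homomorphism : ACR._-Raw-AlmostCommutative⟶_ (CommutativeRing.rawRing ℚP.+-*-commutativeRing)
                                                 (ACR.fromCommutativeRing seriesCommutativeRing)
cst-homomorphism = record
  { ⟦_⟧ = cst
  ; +-homo = λ p q n i j → ℚP.*-distribʳ-+ (one n i j) p q
  ; *-homo = λ p q n i j → trans (ℚP.*-assoc p q (one n i j)) (sym (cst-⊛ p (cst q) n i j))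
  ; -‿homo = λ p n i j → sym (ℚP.neg-distribˡ-* p (one n i j))
  ; 0-homo = λ n i j → ℚP.*-zeroˡ (one n i j)
  ; 1-homo = λ n i j → ℚP.*-identityˡ (one n i j) }

cst-≟ : ∀ p q → Maybe (cst p ≈ cst q)
cst-≟ p q with p ℚP.≟ q
... | yes refl = just ≈-refl
... | no _     = nothing

module Series-Solver = RingSolver (CommutativeRing.rawRing ℚP.+-*-commutativeRing)
  (ACR.fromCommutativeRing seriesCommutativeRing) cst-homomorphism cst-≟

cst1 : cst 1ℚ ≈ one
cst1 n i j = ℚP.*-identityˡ (one n i j)

scale≈cst⊛ : ∀ q F → scale q F ≈ cst q ⊛ F
scale≈cst⊛ q F = ≈-sym (cst-⊛ q F)

shift : (ℕ → ℚ) → ℕ → ℚ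
shift f zero    = 0ℚ
shift f (suc k) = f k

shift-cong : ∀ {f g : ℕ → ℚ} → (∀ k → f k ≡ g k) → ∀ m → shift f m ≡ shift g m
shift-cong f≗g zero    = refl
shift-cong f≗g (suc m) = f≗g m

shift-zero : ∀ {f : ℕ → ℚ} → (∀ k → f k ≡ 0ℚ) → ∀ m → shift f m ≡ 0ℚ
shift-zero f≗0 zero    = refl
shift-zero f≗0 (suc m) = f≗0 m

shift-*ʳ : ∀ (f : ℕ → ℚ) q m → shift f m * q ≡ shift (λ k → f k * q) m
shift-*ʳ f q zero    = ℚP.*-zeroˡ q
shift-*ʳ f q (suc m) = refl

X⊛-coeff : ∀ F n i j → (X ⊛ F) n i j ≡ shift (λ i′ → F n i′ j) i
X⊛-coeff F n zero j = sumTo-zero n λ a _ → sumTo-zero j λ c _ → X⊛-vanishes a c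
  where
  X⊛-vanishes : ∀ a c → X a 0 c * F (n ∸ a) 0 (j ∸ c) ≡ 0ℚ
  X⊛-vanishes zero    c = ℚP.*-zeroˡ (F n 0 (j ∸ c))
  X⊛-vanishes (suc a) c = ℚP.*-zeroˡ (F (n ∸ suc a) 0 (j ∸ c))
X⊛-coeff F n (suc i) j =
  trans (sumTo-onlyHead n _ (λ a → Σ²-zero (suc i) j λ b c → ℚP.*-zeroˡ (F (n ∸ suc a) (suc i ∸ b) (j ∸ c))))
  (trans (sumTo-head i _)
  (trans (cong₂ _+_ (sumTo-zero j (λ c _ → ℚP.*-zeroˡ (F n (suc i) (j ∸ c))))
                    (sumTo-onlyHead i _ (λ b → sumTo-zero j λ c _ → ℚP.*-zeroˡ (F n (i ∸ suc b) (j ∸ c)))))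
  (trans (ℚP.+-identityˡ _)
  (trans (sumTo-onlyHead j _ (λ c → ℚP.*-zeroˡ (F n i (j ∸ suc c))))
  (ℚP.*-identityˡ (F n i j))))))

Y⊛-coeff : ∀ F n i j → (Y ⊛ F) n i j ≡ shift (λ j′ → F n i j′) j
Y⊛-coeff F n i zero = sumTo-zero n λ a _ → sumTo-zero i λ b _ → Y⊛-vanishes a b
  where
  Y⊛-vanishes : ∀ a b → Y a b 0 * F (n ∸ a) (i ∸ b) 0 ≡ 0ℚ
  Y⊛-vanishes zero    zero    = ℚP.*-zeroˡ (F n i 0)
  Y⊛-vanishes zero    (suc b) = ℚP.*-zeroˡ (F n (i ∸ suc b) 0)
  Y⊛-vanishes (suc a) b       = ℚP.*-zeroˡ (F (n ∸ suc a) (i ∸ b) 0)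
Y⊛-coeff F n i (suc j) =
  trans (sumTo-onlyHead n _ (λ a → Σ²-zero i (suc j) λ b c → ℚP.*-zeroˡ (F (n ∸ suc a) (i ∸ b) (suc j ∸ c))))
  (trans (sumTo-onlyHead i _ (λ b → sumTo-zero (suc j) λ c _ → ℚP.*-zeroˡ (F n (i ∸ suc b) (suc j ∸ c))))
  (trans (sumTo-head j _)
  (trans (cong₂ _+_ (ℚP.*-zeroˡ (F n i (suc j)))
                    (sumTo-onlyHead j _ (λ c → ℚP.*-zeroˡ (F n i (j ∸ suc c)))))
  (trans (ℚP.+-identityˡ _) (ℚP.*-identityˡ (F n i j))))))

Z⊛-coeff : ∀ F n i j → (Z ⊛ F) n i j ≡ shift (λ n′ → F n′ i j) n
Z⊛-coeff F zero i j = Σ²-zero i j λ b c → ℚP.*-zeroˡ (F 0 (i ∸ b) (j ∸ c))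
Z⊛-coeff F (suc n) i j =
  trans (sumTo-head n _)
  (trans (cong₂ _+_ (Σ²-zero i j λ b c → ℚP.*-zeroˡ (F (suc n) (i ∸ b) (j ∸ c)))
                    (sumTo-onlyHead n _ (λ a → Σ²-zero i j λ b c → ℚP.*-zeroˡ (F (n ∸ suc a) (i ∸ b) (j ∸ c)))))
  (trans (ℚP.+-identityˡ _)
  (trans (sumTo-onlyHead i _ (λ b → sumTo-zero j λ c _ → ℚP.*-zeroˡ (F n (i ∸ suc b) (j ∸ c))))
  (trans (sumTo-onlyHead j _ (λ c → ℚP.*-zeroˡ (F n i (j ∸ suc c))))
  (ℚP.*-identityˡ (F n i j))))))

ι : ℤ → ℚ
ι z = z ℚ./ 1

private
  fromℚᵘ-+ : ∀ p q → fromℚᵘ p + fromℚᵘ q ≡ fromℚᵘ (p ℚᵘ.+ q)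
  fromℚᵘ-+ p q = ℚP.toℚᵘ-injective (ℚᵘP.≃-trans (ℚP.toℚᵘ-homo-+ (fromℚᵘ p) (fromℚᵘ q))
    (ℚᵘP.≃-trans (ℚᵘP.+-cong (ℚP.toℚᵘ-fromℚᵘ p) (ℚP.toℚᵘ-fromℚᵘ q))
                 (ℚᵘP.≃-sym (ℚP.toℚᵘ-fromℚᵘ (p ℚᵘ.+ q)))))

  fromℚᵘ-* : ∀ p q → fromℚᵘ p * fromℚᵘ q ≡ fromℚᵘ (p ℚᵘ.* q)
  fromℚᵘ-* p q = ℚP.toℚᵘ-injective (ℚᵘP.≃-trans (ℚP.toℚᵘ-homo-* (fromℚᵘ p) (fromℚᵘ q))
    (ℚᵘP.≃-trans (ℚᵘP.*-cong (ℚP.toℚᵘ-fromℚᵘ p) (ℚP.toℚᵘ-fromℚᵘ q))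
                 (ℚᵘP.≃-sym (ℚP.toℚᵘ-fromℚᵘ (p ℚᵘ.* q)))))

  fromℚᵘ-neg : ∀ p → - fromℚᵘ p ≡ fromℚᵘ (ℚᵘ.- p)
  fromℚᵘ-neg p = ℚP.toℚᵘ-injective (ℚᵘP.≃-trans (ℚP.toℚᵘ-homo‿- (fromℚᵘ p))
    (ℚᵘP.≃-trans (ℚᵘP.-‿cong (ℚP.toℚᵘ-fromℚᵘ p)) (ℚᵘP.≃-sym (ℚP.toℚᵘ-fromℚᵘ (ℚᵘ.- p)))))

  fromℚᵘ-cong : ∀ p q → p ℚᵘ.≃ q → fromℚᵘ p ≡ fromℚᵘ q
  fromℚᵘ-cong p q = ℚP.fromℚᵘ-cong {p} {q}

-- ι z is fromℚᵘ (mkℚᵘ z 0) by definition, so ι inherits the arithmetic of ℚᵘ.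
ι-+ : ∀ a b → ι (a ℤ.+ b) ≡ ι a + ι b
ι-+ a b = sym (trans (fromℚᵘ-+ (ℚᵘ.mkℚᵘ a 0) (ℚᵘ.mkℚᵘ b 0))
  (fromℚᵘ-cong (ℚᵘ.mkℚᵘ a 0 ℚᵘ.+ ℚᵘ.mkℚᵘ b 0) (ℚᵘ.mkℚᵘ (a ℤ.+ b) 0) (ℚᵘ.*≡*
    (solve 2 (λ a b → (a :* con (ℤ.+ 1) :+ b :* con (ℤ.+ 1)) :* con (ℤ.+ 1) := (a :+ b) :* con (ℤ.+ 1))
           refl a b))))
  where open ℤ-Solver.+-*-Solver

ι-* : ∀ a b → ι (a ℤ.* b) ≡ ι a * ι b
ι-* a b = sym (trans (fromℚᵘ-* (ℚᵘ.mkℚᵘ a 0) (ℚᵘ.mkℚᵘ b 0))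
  (fromℚᵘ-cong (ℚᵘ.mkℚᵘ a 0 ℚᵘ.* ℚᵘ.mkℚᵘ b 0) (ℚᵘ.mkℚᵘ (a ℤ.* b) 0) (ℚᵘ.*≡* refl)))

ι-neg : ∀ a → ι (ℤ.- a) ≡ - ι a
ι-neg a = sym (trans (fromℚᵘ-neg (ℚᵘ.mkℚᵘ a 0))
  (fromℚᵘ-cong (ℚᵘ.- ℚᵘ.mkℚᵘ a 0) (ℚᵘ.mkℚᵘ (ℤ.- a) 0) (ℚᵘ.*≡* refl)))

ι-- : ∀ a b → ι (a ℤ.- b) ≡ ι a - ι b
ι-- a b = trans (ι-+ a (ℤ.- b)) (cong (ι a +_) (ι-neg b))

fromℕ-+ : ∀ m k → fromℕ (m ℕ.+ k) ≡ fromℕ m + fromℕ k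
fromℕ-+ m k = trans (cong ι (ℤP.pos-+ m k)) (ι-+ (ℤ.+ m) (ℤ.+ k))

fromℕ-* : ∀ m k → fromℕ (m ℕ.* k) ≡ fromℕ m * fromℕ k
fromℕ-* m k = trans (cong ι (ℤP.pos-* m k)) (ι-* (ℤ.+ m) (ℤ.+ k))

[1+m]*1/[[1+m]*n]≡1/n : ∀ m n .{{_ : ℕ.NonZero n}} →
  fromℕ (suc m) * ℚ._/_ (ℤ.+ 1) (suc m ℕ.* n) {{ℕP.m*n≢0 (suc m) n}} ≡ (ℤ.+ 1) ℚ./ n
[1+m]*1/[[1+m]*n]≡1/n m (suc k) =
  trans (fromℚᵘ-* (ℚᵘ.mkℚᵘ (ℤ.+ suc m) 0) (ℚᵘ.mkℚᵘ (ℤ.+ 1) (k ℕ.+ m ℕ.* suc k)))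
        (fromℚᵘ-cong (ℚᵘ.mkℚᵘ (ℤ.+ suc m) 0 ℚᵘ.* ℚᵘ.mkℚᵘ (ℤ.+ 1) (k ℕ.+ m ℕ.* suc k))
                     (ℚᵘ.mkℚᵘ (ℤ.+ 1) k)
          (ℚᵘ.*≡* (trans (solve 2 (λ x y → (x :* con (ℤ.+ 1)) :* y := con (ℤ.+ 1) :* (x :* y)) refl
                                  (ℤ.+ suc m) (ℤ.+ suc k))
                  (trans (cong (ℤ.+ 1 ℤ.*_) (sym (ℤP.pos-* (suc m) (suc k))))
                         (cong (λ t → ℤ.+ 1 ℤ.* ℤ.+ suc t) (sym (ℕP.+-identityʳ _)))))))
  where open ℤ-Solver.+-*-Solver

invFact-suc : ∀ m → fromℕ (suc m) * invFact (suc m) ≡ invFact m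
invFact-suc m = [1+m]*1/[[1+m]*n]≡1/n m (m !) {{m ℕP.!≢0}}

[1+n]*x≡0⇒x≡0 : ∀ n x → fromℕ (suc n) * x ≡ 0ℚ → x ≡ 0ℚ
[1+n]*x≡0⇒x≡0 n x [1+n]x≡0 = begin
    x                               ≡⟨ sym (ℚP.*-identityˡ x) ⟩
    1ℚ * x                          ≡⟨ cong (_* x) (sym ([1+m]*1/[[1+m]*n]≡1/n n 1)) ⟩
    fromℕ (suc n) * 1/[1+n] * x     ≡⟨ cong (_* x) (ℚP.*-comm (fromℕ (suc n)) 1/[1+n]) ⟩
    1/[1+n] * fromℕ (suc n) * x     ≡⟨ ℚP.*-assoc 1/[1+n] (fromℕ (suc n)) x ⟩
    1/[1+n] * (fromℕ (suc n) * x)   ≡⟨ cong (1/[1+n] *_) [1+n]x≡0 ⟩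
    1/[1+n] * 0ℚ                    ≡⟨ ℚP.*-zeroʳ 1/[1+n] ⟩
    0ℚ                              ∎
  where
  open ≡-Reasoning
  1/[1+n] : ℚ
  1/[1+n] = ℚ._/_ (ℤ.+ 1) (suc n ℕ.* 1) {{ℕP.m*n≢0 (suc n) 1}}

Dz Dx Dy : Series → Series
Dz F n i j = fromℕ (suc n) * F (suc n) i j
Dx F n i j = fromℕ (suc i) * F n (suc i) j
Dy F n i j = fromℕ (suc j) * F n i (suc j)

Z⊛Dz-coeff : ∀ F n i j → (Z ⊛ Dz F) n i j ≡ fromℕ n * F n i j
Z⊛Dz-coeff F zero    i j = trans (Z⊛-coeff (Dz F) 0 i j) (sym (ℚP.*-zeroˡ (F 0 i j)))
Z⊛Dz-coeff F (suc n) i j = Z⊛-coeff (Dz F) (suc n) i j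

X⊛Dx-coeff : ∀ F n i j → (X ⊛ Dx F) n i j ≡ fromℕ i * F n i j
X⊛Dx-coeff F n zero    j = trans (X⊛-coeff (Dx F) n 0 j) (sym (ℚP.*-zeroˡ (F n 0 j)))
X⊛Dx-coeff F n (suc i) j = X⊛-coeff (Dx F) n (suc i) j

Y⊛Dy-coeff : ∀ F n i j → (Y ⊛ Dy F) n i j ≡ fromℕ j * F n i j
Y⊛Dy-coeff F n i zero    = trans (Y⊛-coeff (Dy F) n i 0) (sym (ℚP.*-zeroˡ (F n i 0)))
Y⊛Dy-coeff F n i (suc j) = Y⊛-coeff (Dy F) n i (suc j)

-- The weight n + 1 splits as (a + 1) + (n - a).
sumTo-leibniz : ∀ n (h : ℕ → ℕ → ℚ) →
  fromℕ (suc n) * sumTo (suc n) (λ a → h a (suc n ∸ a)) ≡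
  sumTo n (λ a → fromℕ (suc a) * h (suc a) (n ∸ a)) + sumTo n (λ a → fromℕ (suc (n ∸ a)) * h a (suc (n ∸ a)))
sumTo-leibniz n h = begin
    fromℕ (suc n) * sumTo (suc n) (λ a → h a (suc n ∸ a))
  ≡⟨ sumTo-*ˡ (suc n) (fromℕ (suc n)) _ ⟩
    sumTo (suc n) (λ a → fromℕ (suc n) * h a (suc n ∸ a))
  ≡⟨ sumTo-cong≤ (suc n) split-weight ⟩
    sumTo (suc n) (λ a → fromℕ a * h a (suc n ∸ a) + fromℕ (suc n ∸ a) * h a (suc n ∸ a))
  ≡⟨ sumTo-+ (suc n) _ _ ⟩
    sumTo (suc n) (λ a → fromℕ a * h a (suc n ∸ a)) + sumTo (suc n) (λ a → fromℕ (suc n ∸ a) * h a (suc n ∸ a))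
  ≡⟨ cong₂ _+_ drop-first drop-last ⟩
    sumTo n (λ a → fromℕ (suc a) * h (suc a) (n ∸ a)) + sumTo n (λ a → fromℕ (suc (n ∸ a)) * h a (suc (n ∸ a)))
  ∎
  where
  open ≡-Reasoning
  split-weight : ∀ a → a ≤ suc n →
    fromℕ (suc n) * h a (suc n ∸ a) ≡ fromℕ a * h a (suc n ∸ a) + fromℕ (suc n ∸ a) * h a (suc n ∸ a)
  split-weight a a≤ =
    trans (cong (λ t → fromℕ t * h a (suc n ∸ a)) (sym (ℕP.m+[n∸m]≡n a≤)))
    (trans (cong (_* h a (suc n ∸ a)) (fromℕ-+ a (suc n ∸ a)))
           (ℚP.*-distribʳ-+ (h a (suc n ∸ a)) (fromℕ a) (fromℕ (suc n ∸ a))))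
  drop-first : sumTo (suc n) (λ a → fromℕ a * h a (suc n ∸ a)) ≡ sumTo n (λ a → fromℕ (suc a) * h (suc a) (n ∸ a))
  drop-first = trans (sumTo-head n _)
    (trans (cong (_+ sumTo n (λ a → fromℕ (suc a) * h (suc a) (n ∸ a))) (ℚP.*-zeroˡ (h 0 (suc n))))
           (ℚP.+-identityˡ _))
  drop-last : sumTo (suc n) (λ a → fromℕ (suc n ∸ a) * h a (suc n ∸ a))
            ≡ sumTo n (λ a → fromℕ (suc (n ∸ a)) * h a (suc (n ∸ a)))
  drop-last =
    trans (sumTo-lastZero n _ (trans (cong (λ t → fromℕ t * h (suc n) t) (ℕP.n∸n≡0 n)) (ℚP.*-zeroˡ (h (suc n) 0))))
          (sumTo-cong≤ n (λ a a≤ → cong (λ t → fromℕ t * h a t) (ℕP.+-∸-assoc 1 a≤)))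

private
  *-pull : ∀ q x y → q * (x * y) ≡ x * (q * y)
  *-pull = ℚ-Solver.+-*-Solver.solve 3 (λ q x y → q :* (x :* y) := x :* (q :* y)) refl
    where open ℚ-Solver.+-*-Solver

Dz-leibniz : ∀ F G → Dz (F ⊛ G) ≈ (Dz F ⊛ G) ⊕ (F ⊛ Dz G)
Dz-leibniz F G n i j =
  trans (sumTo-leibniz n (λ a a′ → Σ² i j λ b c → F a b c * G a′ (i ∸ b) (j ∸ c)))
  (cong₂ _+_
    (sumTo-cong n λ a → trans (Σ²-*ˡ i j (fromℕ (suc a)) _)
      (sumTo-cong i λ b → sumTo-cong j λ c → sym (ℚP.*-assoc (fromℕ (suc a)) (F (suc a) b c) _)))
    (sumTo-cong n λ a → trans (Σ²-*ˡ i j (fromℕ (suc (n ∸ a))) _)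
      (sumTo-cong i λ b → sumTo-cong j λ c → *-pull (fromℕ (suc (n ∸ a))) (F a b c) _)))

Dx-leibniz : ∀ F G → Dx (F ⊛ G) ≈ (Dx F ⊛ G) ⊕ (F ⊛ Dx G)
Dx-leibniz F G n i j =
  trans (sumTo-*ˡ n (fromℕ (suc i)) _)
  (trans (sumTo-cong n λ a → trans (sumTo-leibniz i (λ b b′ → sumTo j λ c → F a b c * G (n ∸ a) b′ (j ∸ c)))
     (cong₂ _+_
       (sumTo-cong i λ b → trans (sumTo-*ˡ j (fromℕ (suc b)) _)
         (sumTo-cong j λ c → sym (ℚP.*-assoc (fromℕ (suc b)) (F a (suc b) c) _)))
       (sumTo-cong i λ b → trans (sumTo-*ˡ j (fromℕ (suc (i ∸ b))) _)
         (sumTo-cong j λ c → *-pull (fromℕ (suc (i ∸ b))) (F a b c) _))))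
  (sumTo-+ n _ _))

Dy-leibniz : ∀ F G → Dy (F ⊛ G) ≈ (Dy F ⊛ G) ⊕ (F ⊛ Dy G)
Dy-leibniz F G n i j =
  trans (sumTo-*ˡ n (fromℕ (suc j)) _)
  (trans (sumTo-cong n λ a → trans (sumTo-*ˡ i (fromℕ (suc j)) _)
     (trans (sumTo-cong i λ b → trans (sumTo-leibniz j (λ c c′ → F a b c * G (n ∸ a) (i ∸ b) c′))
        (cong₂ _+_ (sumTo-cong j λ c → sym (ℚP.*-assoc (fromℕ (suc c)) (F a b (suc c)) _))
                   (sumTo-cong j λ c → *-pull (fromℕ (suc (j ∸ c))) (F a b c) _)))
     (sumTo-+ i _ _)))
  (sumTo-+ n _ _))

AgreeUpTo : ℕ → Series → Series → Set
AgreeUpTo n F G = ∀ m → m ≤ n → ∀ i j → F m i j ≡ G m i j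

⊛-local : ∀ n {F F′ G G′} → AgreeUpTo n F F′ → AgreeUpTo n G G′ → AgreeUpTo n (F ⊛ G) (F′ ⊛ G′)
⊛-local n F≈F′ G≈G′ m m≤n i j = sumTo-cong≤ m λ a a≤m → sumTo-cong i λ b → sumTo-cong j λ c →
  cong₂ _*_ (F≈F′ a (ℕP.≤-trans a≤m m≤n) b c)
            (G≈G′ (m ∸ a) (ℕP.≤-trans (ℕP.m∸n≤m m a) m≤n) (i ∸ b) (j ∸ c))

record IsDerivation (D : Series → Series) : Set where
  field
    d-cong    : ∀ {F G} → F ≈ G → D F ≈ D G
    d-+       : ∀ F G → D (F ⊕ G) ≈ D F ⊕ D G
    d-scale   : ∀ q F → D (scale q F) ≈ scale q (D F)
    d-leibniz : ∀ F G → D (F ⊛ G) ≈ (D F ⊛ G) ⊕ (F ⊛ D G)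
    d-one     : D one ≈ zeroS
    d-local   : ∀ n {F G} → AgreeUpTo (suc n) F G → ∀ i j → D F n i j ≡ D G n i j

Dz-isDerivation : IsDerivation Dz
Dz-isDerivation = record
  { d-cong    = λ F≈G n i j → cong (fromℕ (suc n) *_) (F≈G (suc n) i j)
  ; d-+       = λ F G n i j → ℚP.*-distribˡ-+ (fromℕ (suc n)) (F (suc n) i j) (G (suc n) i j)
  ; d-scale   = λ q F n i j → *-pull (fromℕ (suc n)) q (F (suc n) i j)
  ; d-leibniz = Dz-leibniz
  ; d-one     = λ n i j → ℚP.*-zeroʳ (fromℕ (suc n))
  ; d-local   = λ n F≈G i j → cong (fromℕ (suc n) *_) (F≈G (suc n) ℕP.≤-refl i j) }

Dx-isDerivation : IsDerivation Dx
Dx-isDerivation = record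
  { d-cong    = λ F≈G n i j → cong (fromℕ (suc i) *_) (F≈G n (suc i) j)
  ; d-+       = λ F G n i j → ℚP.*-distribˡ-+ (fromℕ (suc i)) (F n (suc i) j) (G n (suc i) j)
  ; d-scale   = λ q F n i j → *-pull (fromℕ (suc i)) q (F n (suc i) j)
  ; d-leibniz = Dx-leibniz
  ; d-one     = λ { zero i zero → ℚP.*-zeroʳ (fromℕ (suc i)) ; zero i (suc j) → ℚP.*-zeroʳ (fromℕ (suc i))
                  ; (suc n) i j → ℚP.*-zeroʳ (fromℕ (suc i)) }
  ; d-local   = λ n F≈G i j → cong (fromℕ (suc i) *_) (F≈G n (ℕP.n≤1+n n) (suc i) j) }

Dy-isDerivation : IsDerivation Dy
Dy-isDerivation = record
  { d-cong    = λ F≈G n i j → cong (fromℕ (suc j) *_) (F≈G n i (suc j))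
  ; d-+       = λ F G n i j → ℚP.*-distribˡ-+ (fromℕ (suc j)) (F n i (suc j)) (G n i (suc j))
  ; d-scale   = λ q F n i j → *-pull (fromℕ (suc j)) q (F n i (suc j))
  ; d-leibniz = Dy-leibniz
  ; d-one     = λ { zero zero j → ℚP.*-zeroʳ (fromℕ (suc j)) ; zero (suc i) j → ℚP.*-zeroʳ (fromℕ (suc j))
                  ; (suc n) i j → ℚP.*-zeroʳ (fromℕ (suc j)) }
  ; d-local   = λ n F≈G i j → cong (fromℕ (suc j) *_) (F≈G n (ℕP.n≤1+n n) i (suc j)) }

cst0 : cst 0ℚ ≈ zeroS
cst0 n i j = ℚP.*-zeroˡ (one n i j)

private
  ≈zeroS⇒≈cst0 : ∀ {F} → F ≈ zeroS → F ≈ cst 0ℚ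
  ≈zeroS⇒≈cst0 F≈0 = ≈-trans F≈0 (≈-sym cst0)

  ≈one⇒≈cst1 : ∀ {F} → F ≈ one → F ≈ cst 1ℚ
  ≈one⇒≈cst1 F≈1 = ≈-trans F≈1 (≈-sym cst1)

Dz-X : Dz X ≈ cst 0ℚ
Dz-X = ≈zeroS⇒≈cst0 λ n i j → ℚP.*-zeroʳ (fromℕ (suc n))

Dz-Y : Dz Y ≈ cst 0ℚ
Dz-Y = ≈zeroS⇒≈cst0 λ n i j → ℚP.*-zeroʳ (fromℕ (suc n))

Dz-Z : Dz Z ≈ cst 1ℚ
Dz-Z = ≈one⇒≈cst1 λ
  { zero zero zero → refl ; zero zero (suc j) → ℚP.*-zeroʳ 1ℚ ; zero (suc i) j → ℚP.*-zeroʳ 1ℚ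
  ; (suc n) i j → ℚP.*-zeroʳ (fromℕ (suc (suc n))) }

Dx-X : Dx X ≈ cst 1ℚ
Dx-X = ≈one⇒≈cst1 λ
  { zero zero zero → refl ; zero zero (suc j) → ℚP.*-zeroʳ 1ℚ ; zero (suc i) j → ℚP.*-zeroʳ (fromℕ (suc (suc i)))
  ; (suc n) i j → ℚP.*-zeroʳ (fromℕ (suc i)) }

Dx-Y : Dx Y ≈ cst 0ℚ
Dx-Y = ≈zeroS⇒≈cst0 λ { zero i j → ℚP.*-zeroʳ (fromℕ (suc i)) ; (suc n) i j → ℚP.*-zeroʳ (fromℕ (suc i)) }

Dx-Z : Dx Z ≈ cst 0ℚ
Dx-Z = ≈zeroS⇒≈cst0 λ
  { zero i j → ℚP.*-zeroʳ (fromℕ (suc i)) ; (suc zero) i j → ℚP.*-zeroʳ (fromℕ (suc i))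
  ; (suc (suc n)) i j → ℚP.*-zeroʳ (fromℕ (suc i)) }

Dy-X : Dy X ≈ cst 0ℚ
Dy-X = ≈zeroS⇒≈cst0 λ
  { zero zero j → ℚP.*-zeroʳ (fromℕ (suc j)) ; zero (suc zero) j → ℚP.*-zeroʳ (fromℕ (suc j))
  ; zero (suc (suc i)) j → ℚP.*-zeroʳ (fromℕ (suc j)) ; (suc n) i j → ℚP.*-zeroʳ (fromℕ (suc j)) }

Dy-Y : Dy Y ≈ cst 1ℚ
Dy-Y = ≈one⇒≈cst1 λ
  { zero zero zero → refl ; zero zero (suc j) → ℚP.*-zeroʳ (fromℕ (suc (suc j)))
  ; zero (suc i) j → ℚP.*-zeroʳ (fromℕ (suc j)) ; (suc n) i j → ℚP.*-zeroʳ (fromℕ (suc j)) }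

Dy-Z : Dy Z ≈ cst 0ℚ
Dy-Z = ≈zeroS⇒≈cst0 λ
  { zero i j → ℚP.*-zeroʳ (fromℕ (suc j)) ; (suc zero) zero j → ℚP.*-zeroʳ (fromℕ (suc j))
  ; (suc zero) (suc i) j → ℚP.*-zeroʳ (fromℕ (suc j)) ; (suc (suc n)) i j → ℚP.*-zeroʳ (fromℕ (suc j)) }

-- Substitution into a power series

VanishesAtZ0 : Series → Set
VanishesAtZ0 W = ∀ i j → W 0 i j ≡ 0ℚ

VanishesAtZ0-⊛ : ∀ {F} G → VanishesAtZ0 F → VanishesAtZ0 (F ⊛ G)
VanishesAtZ0-⊛ {F} G F₀≡0 i j = Σ²-zero i j λ b c →
  trans (cong (_* G 0 (i ∸ b) (j ∸ c)) (F₀≡0 b c)) (ℚP.*-zeroˡ (G 0 (i ∸ b) (j ∸ c)))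

VanishesAtZ0-scale : ∀ q {F} → VanishesAtZ0 F → VanishesAtZ0 (scale q F)
VanishesAtZ0-scale q F₀≡0 i j = trans (cong (q *_) (F₀≡0 i j)) (ℚP.*-zeroʳ q)

pow-vanishes : ∀ {W} → VanishesAtZ0 W → ∀ k n → n < k → ∀ i j → pow W k n i j ≡ 0ℚ
pow-vanishes {W} W₀≡0 (suc k) zero    n<k i j = VanishesAtZ0-⊛ {W} (pow W k) W₀≡0 i j
pow-vanishes {W} W₀≡0 (suc k) (suc n) (s≤s n<k) i j =
  trans (sumTo-head n _)
  (trans (cong₂ _+_ (Σ²-zero i j λ b c → trans (cong (_* pow W k (suc n) (i ∸ b) (j ∸ c)) (W₀≡0 b c))
                                                 (ℚP.*-zeroˡ (pow W k (suc n) (i ∸ b) (j ∸ c))))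
                    (sumTo-zero n λ a _ → Σ²-zero i j λ b c →
                       trans (cong (W (suc a) b c *_)
                                   (pow-vanishes {W} W₀≡0 k (n ∸ a) (ℕP.<-≤-trans (s≤s (ℕP.m∸n≤m n a)) n<k)
                                                 (i ∸ b) (j ∸ c)))
                             (ℚP.*-zeroʳ (W (suc a) b c))))
         (ℚP.+-identityʳ 0ℚ))

seriesSum : ℕ → (ℕ → Series) → Series
seriesSum N f n i j = sumTo N (λ k → f k n i j)

seriesSum-⊛ : ∀ N f G → seriesSum N f ⊛ G ≈ seriesSum N (λ k → f k ⊛ G)
seriesSum-⊛ zero    f G = ≈-refl
seriesSum-⊛ (suc N) f G = ≈-trans (⊛-distribʳ G (seriesSum N f) (f (suc N))) (⊕-cong (seriesSum-⊛ N f G) ≈-refl)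

⊛-seriesSum : ∀ N f G → G ⊛ seriesSum N f ≈ seriesSum N (λ k → G ⊛ f k)
⊛-seriesSum zero    f G = ≈-refl
⊛-seriesSum (suc N) f G = ≈-trans (⊛-distribˡ G (seriesSum N f) (f (suc N))) (⊕-cong (⊛-seriesSum N f G) ≈-refl)

polySubst : ℕ → (ℕ → ℚ) → Series → Series
polySubst N a W = seriesSum N (λ k → scale (a k) (pow W k))

subst≈polySubst : ∀ {W} → VanishesAtZ0 W → ∀ a N → AgreeUpTo N (subst a W) (polySubst N a W)
subst≈polySubst W₀≡0 a N m m≤N i j = sym (sumTo-extend _ m≤N λ k m<k →
  trans (cong (a k *_) (pow-vanishes W₀≡0 k m m<k i j)) (ℚP.*-zeroʳ (a k)))

subst-cong : ∀ {a b} W → (∀ k → a k ≡ b k) → subst a W ≈ subst b W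
subst-cong W a≗b n i j = sumTo-cong n λ k → cong (_* pow W k n i j) (a≗b k)

subst-+ : ∀ a b W → subst (λ k → a k + b k) W ≈ subst a W ⊕ subst b W
subst-+ a b W n i j = trans (sumTo-cong n λ k → ℚP.*-distribʳ-+ (pow W k n i j) (a k) (b k)) (sumTo-+ n _ _)

subst-neg : ∀ a W → subst (λ k → - a k) W ≈ negS (subst a W)
subst-neg a W n i j = trans (sumTo-cong n λ k → sym (ℚP.neg-distribˡ-* (a k) (pow W k n i j))) (sumTo-neg n _)

subst-scale : ∀ q a W → subst (λ k → q * a k) W ≈ scale q (subst a W)
subst-scale q a W n i j = trans (sumTo-cong n λ k → ℚP.*-assoc q (a k) (pow W k n i j)) (sym (sumTo-*ˡ n q _))

⊛-scaleʳ : ∀ q F G → F ⊛ scale q G ≈ scale q (F ⊛ G)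
⊛-scaleʳ q F G =
  ≈-trans (⊛-comm F (scale q G)) (≈-trans (scale-⊛ q G F) (λ n i j → cong (q *_) (⊛-comm G F n i j)))

subst-shift : ∀ {W} → VanishesAtZ0 W → ∀ b → W ⊛ subst b W ≈ subst (shift b) W
subst-shift {W} W₀≡0 b n i j = begin
    (W ⊛ subst b W) n i j
  ≡⟨ ⊛-local n {W} {W} (λ _ _ _ _ → refl) (subst≈polySubst W₀≡0 b n) n ℕP.≤-refl i j ⟩
    (W ⊛ polySubst n b W) n i j
  ≡⟨ ⊛-seriesSum n (λ k → scale (b k) (pow W k)) W n i j ⟩
    sumTo n (λ k → (W ⊛ scale (b k) (pow W k)) n i j)
  ≡⟨ sumTo-cong n (λ k → ⊛-scaleʳ (b k) W (pow W k) n i j) ⟩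
    sumTo n (λ k → b k * pow W (suc k) n i j)
  ≡⟨ sym (trans (sumTo-head n _) (trans (cong (_+ sumTo n (λ k → b k * pow W (suc k) n i j)) (ℚP.*-zeroˡ (one n i j)))
                                         (ℚP.+-identityˡ _))) ⟩
    sumTo (suc n) (λ k → shift b k * pow W k n i j)
  ≡⟨ sumTo-lastZero n _ (trans (cong (b n *_) (pow-vanishes {W} W₀≡0 (suc n) n ℕP.≤-refl i j)) (ℚP.*-zeroʳ (b n))) ⟩
    subst (shift b) W n i j
  ∎
  where open ≡-Reasoning

-- geom T = Σ T^k, so T ⊛ geom T is geom T without its constant term 1.
geom-inverse : ∀ {T} → VanishesAtZ0 T → geom T ⊛ (one ⊖ T) ≈ one
geom-inverse {T} T₀≡0 = begin
    geom T ⊛ (one ⊖ T)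
  ≈⟨ ⊛-distribˡ (geom T) one (negS T) ⟩
    geom T ⊛ one ⊕ geom T ⊛ negS T
  ≈⟨ ⊕-cong (⊛-identityʳ (geom T)) (≈-trans (⊛-comm (geom T) (negS T)) negS-⊛) ⟩
    geom T ⊕ negS (T ⊛ geom T)
  ≈⟨ ⊕-cong {geom T} ≈-refl (λ n i j → cong -_ (subst-shift T₀≡0 (λ _ → 1ℚ) n i j)) ⟩
    subst (λ _ → 1ℚ) T ⊕ negS (subst (shift (λ _ → 1ℚ)) T)
  ≈⟨ ≈-sym (≈-trans (subst-+ (λ _ → 1ℚ) (λ k → - shift (λ _ → 1ℚ) k) T)
                    (⊕-cong {subst (λ _ → 1ℚ) T} ≈-refl (subst-neg (shift (λ _ → 1ℚ)) T))) ⟩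
    subst (λ k → 1ℚ - shift (λ _ → 1ℚ) k) T
  ≈⟨ (λ n i j → sumTo-onlyHead n _ (λ k → ℚP.*-zeroˡ (pow T (suc k) n i j))) ⟩
    scale 1ℚ one
  ≈⟨ cst1 ⟩
    one
  ∎
  where
  open ≈-Reasoning
  negS-⊛ : negS T ⊛ geom T ≈ negS (T ⊛ geom T)
  negS-⊛ n i j = trans (sumTo-cong n λ a → sumTo-cong i λ b → sumTo-cong j λ c →
    sym (ℚP.neg-distribˡ-* (T a b c) _)) (Σ³-neg n i j _)

derivative : (ℕ → ℚ) → ℕ → ℚ
derivative a k = fromℕ (suc k) * a (suc k)

module DerivationRules {D : Series → Series} (isD : IsDerivation D) where
  open IsDerivation isD public

  d-neg : ∀ F → D (negS F) ≈ negS (D F)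
  d-neg F = ≈-trans (d-cong (λ n i j → neg≡-1* (F n i j)))
                    (≈-trans (d-scale (- 1ℚ) F) (λ n i j → sym (neg≡-1* (D F n i j))))
    where
    neg≡-1* : ∀ x → - x ≡ (- 1ℚ) * x
    neg≡-1* = ℚ-Solver.+-*-Solver.solve 1 (λ x → :- x := con (- 1ℚ) :* x) refl
      where open ℚ-Solver.+-*-Solver

  d-⊖ : ∀ F G → D (F ⊖ G) ≈ D F ⊖ D G
  d-⊖ F G = ≈-trans (d-+ F (negS G)) (⊕-cong {D F} ≈-refl (d-neg G))

  d-cst : ∀ q → D (cst q) ≈ cst 0ℚ
  d-cst q = ≈-trans (d-scale q one) (λ n i j →
    trans (cong (q *_) (d-one n i j)) (trans (ℚP.*-zeroʳ q) (sym (ℚP.*-zeroˡ (one n i j)))))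

  d-cst⊛ : ∀ q F → D (cst q ⊛ F) ≈ cst q ⊛ D F
  d-cst⊛ q F = ≈-trans (d-cong (cst-⊛ q F)) (≈-trans (d-scale q F) (scale≈cst⊛ q (D F)))

  d-seriesSum : ∀ N f → D (seriesSum N f) ≈ seriesSum N (λ k → D (f k))
  d-seriesSum zero    f = ≈-refl
  d-seriesSum (suc N) f = ≈-trans (d-+ (seriesSum N f) (f (suc N))) (⊕-cong (d-seriesSum N f) ≈-refl)

  d-pow : ∀ W k → D (pow W (suc k)) ≈ scale (fromℕ (suc k)) (pow W k ⊛ D W)
  d-pow W zero = begin
      D (W ⊛ one)
    ≈⟨ d-leibniz W one ⟩
      D W ⊛ one ⊕ W ⊛ D one
    ≈⟨ ⊕-cong (⊛-identityʳ (D W)) (≈-trans (⊛-cong {W} ≈-refl d-one) (⊛-zeroʳ W)) ⟩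
      D W ⊕ zeroS
    ≈⟨ (λ n i j → trans (ℚP.+-identityʳ _) (sym (trans (ℚP.*-identityˡ _) (⊛-identityˡ (D W) n i j)))) ⟩
      scale 1ℚ (one ⊛ D W)
    ∎
    where open ≈-Reasoning
  d-pow W (suc k) = begin
      D (W ⊛ pow W (suc k))
    ≈⟨ d-leibniz W (pow W (suc k)) ⟩
      D W ⊛ pow W (suc k) ⊕ W ⊛ D (pow W (suc k))
    ≈⟨ ⊕-cong (⊛-comm (D W) (pow W (suc k))) (⊛-cong {W} ≈-refl (d-pow W k)) ⟩
      pow W (suc k) ⊛ D W ⊕ W ⊛ scale (fromℕ (suc k)) (pow W k ⊛ D W)
    ≈⟨ ⊕-cong {pow W (suc k) ⊛ D W} ≈-refl
         (≈-trans (⊛-scaleʳ (fromℕ (suc k)) W (pow W k ⊛ D W))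
                  (λ n i j → cong (fromℕ (suc k) *_) (sym (⊛-assoc W (pow W k) (D W) n i j)))) ⟩
      pow W (suc k) ⊛ D W ⊕ scale (fromℕ (suc k)) (pow W (suc k) ⊛ D W)
    ≈⟨ (λ n i j → 1+k-times ((pow W (suc k) ⊛ D W) n i j)) ⟩
      scale (fromℕ (suc (suc k))) (pow W (suc k) ⊛ D W)
    ∎
    where
    open ≈-Reasoning
    1+k-times : ∀ x → x + fromℕ (suc k) * x ≡ fromℕ (suc (suc k)) * x
    1+k-times x = trans (cong (_+ fromℕ (suc k) * x) (sym (ℚP.*-identityˡ x)))
      (trans (sym (ℚP.*-distribʳ-+ x 1ℚ (fromℕ (suc k)))) (cong (_* x) (sym (fromℕ-+ 1 (suc k)))))

  -- Each coefficient of subst a W only involves the polynomial truncation Σ_{k ≤ n+1} a k W^k.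
  chain-rule : ∀ {W} → VanishesAtZ0 W → ∀ a → D (subst a W) ≈ subst (derivative a) W ⊛ D W
  chain-rule {W} W₀≡0 a n i j = begin
      D (subst a W) n i j
    ≡⟨ d-local n (subst≈polySubst W₀≡0 a (suc n)) i j ⟩
      D (polySubst (suc n) a W) n i j
    ≡⟨ d-seriesSum (suc n) _ n i j ⟩
      sumTo (suc n) (λ k → D (scale (a k) (pow W k)) n i j)
    ≡⟨ sumTo-cong (suc n) (λ k → d-scale (a k) (pow W k) n i j) ⟩
      sumTo (suc n) (λ k → a k * D (pow W k) n i j)
    ≡⟨ sumTo-head n _ ⟩
      a 0 * D one n i j + sumTo n (λ k → a (suc k) * D (pow W (suc k)) n i j)
    ≡⟨ cong₂ _+_ (trans (cong (a 0 *_) (d-one n i j)) (ℚP.*-zeroʳ (a 0)))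
                 (sumTo-cong n λ k → trans (cong (a (suc k) *_) (d-pow W k n i j))
                   (trans (sym (ℚP.*-assoc (a (suc k)) (fromℕ (suc k)) _))
                          (cong (_* (pow W k ⊛ D W) n i j) (ℚP.*-comm (a (suc k)) (fromℕ (suc k)))))) ⟩
      0ℚ + sumTo n (λ k → derivative a k * (pow W k ⊛ D W) n i j)
    ≡⟨ ℚP.+-identityˡ _ ⟩
      sumTo n (λ k → derivative a k * (pow W k ⊛ D W) n i j)
    ≡⟨ sym (sumTo-cong n λ k → scale-⊛ (derivative a k) (pow W k) (D W) n i j) ⟩
      sumTo n (λ k → (scale (derivative a k) (pow W k) ⊛ D W) n i j)
    ≡⟨ sym (seriesSum-⊛ n (λ k → scale (derivative a k) (pow W k)) (D W) n i j) ⟩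
      (polySubst n (derivative a) W ⊛ D W) n i j
    ≡⟨ sym (⊛-local n {G = D W} {D W} (subst≈polySubst W₀≡0 (derivative a) n) (λ _ _ _ _ → refl)
                    n ℕP.≤-refl i j) ⟩
      (subst (derivative a) W ⊛ D W) n i j
    ∎
    where open ≡-Reasoning

𝒟-fromPartials : Series → Series → Series → Series
𝒟-fromPartials dz dx dy =
  (cst 1ℚ ⊖ Y ⊛ Z) ⊛ dz ⊖ Y ⊛ (cst 1ℚ ⊖ X) ⊛ dx ⊖ Y ⊛ (cst 1ℚ ⊖ cst (fromℕ 2) ⊛ Y) ⊛ dy

𝒟 : Series → Series
𝒟 F = 𝒟-fromPartials (Dz F) (Dx F) (Dy F)

𝒟-fromPartials-cong : ∀ {dz dz′ dx dx′ dy dy′} → dz ≈ dz′ → dx ≈ dx′ → dy ≈ dy′ →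
  𝒟-fromPartials dz dx dy ≈ 𝒟-fromPartials dz′ dx′ dy′
𝒟-fromPartials-cong dz≈ dx≈ dy≈ =
  ⊖-cong (⊖-cong (⊛-cong {cst 1ℚ ⊖ Y ⊛ Z} ≈-refl dz≈) (⊛-cong {Y ⊛ (cst 1ℚ ⊖ X)} ≈-refl dx≈))
         (⊛-cong {Y ⊛ (cst 1ℚ ⊖ cst (fromℕ 2) ⊛ Y)} ≈-refl dy≈)

private
  module 𝒟-Solver where
    open Series-Solver public using (solve; _:+_; _:*_; _:-_; _:=_; con)
    open Series-Solver using (Polynomial)
    𝒟-poly : ∀ {k} (x y z dz dx dy : Polynomial k) → Polynomial k
    𝒟-poly x y z dz dx dy = (con 1ℚ :- y :* z) :* dz :- y :* (con 1ℚ :- x) :* dx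
                            :- y :* (con 1ℚ :- con (fromℕ 2) :* y) :* dy

𝒟-leibniz : ∀ F G → 𝒟 (F ⊛ G) ≈ 𝒟 F ⊛ G ⊕ F ⊛ 𝒟 G
𝒟-leibniz F G = ≈-trans (𝒟-fromPartials-cong (Dz-leibniz F G) (Dx-leibniz F G) (Dy-leibniz F G))
  (solve 11 (λ f g fz gz fx gx fy gy x y z →
       𝒟-poly x y z (fz :* g :+ f :* gz) (fx :* g :+ f :* gx) (fy :* g :+ f :* gy)
    := 𝒟-poly x y z fz fx fy :* g :+ f :* 𝒟-poly x y z gz gx gy)
    ≈-refl F G (Dz F) (Dz G) (Dx F) (Dx G) (Dy F) (Dy G) X Y Z)
  where open 𝒟-Solver

𝒟-⊖ : ∀ F G → 𝒟 (F ⊖ G) ≈ 𝒟 F ⊖ 𝒟 G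
𝒟-⊖ F G = ≈-trans (𝒟-fromPartials-cong (DZ.d-⊖ F G) (DX.d-⊖ F G) (DY.d-⊖ F G))
  (solve 9 (λ fz gz fx gx fy gy x y z →
       𝒟-poly x y z (fz :- gz) (fx :- gx) (fy :- gy) := 𝒟-poly x y z fz fx fy :- 𝒟-poly x y z gz gx gy)
    ≈-refl (Dz F) (Dz G) (Dx F) (Dx G) (Dy F) (Dy G) X Y Z)
  where
  open 𝒟-Solver
  module DZ = DerivationRules Dz-isDerivation
  module DX = DerivationRules Dx-isDerivation
  module DY = DerivationRules Dy-isDerivation

-- The coefficient of z^n x^i y^j in (yz ∂z + y(1 - x) ∂x + y(1 - 2y) ∂y) F, which only involves
-- the slice f = F n of F: multiplication by y and the Euler operators z ∂z, x ∂x, y ∂y act on it.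
sliceCoeff : (ℕ → ℕ → ℚ) → ℕ → ℕ → ℕ → ℚ
sliceCoeff f n i j =
  shift (λ j′ → fromℕ n * f i j′) j + shift (λ j′ → fromℕ (suc i) * f (suc i) j′) j
  - shift (λ j′ → fromℕ i * f i j′) j + fromℕ j * f i j - fromℕ 2 * shift (λ j′ → fromℕ j′ * f i j′) j

𝒟-coeff : ∀ F n i j → 𝒟 F n i j ≡ Dz F n i j - sliceCoeff (F n) n i j
𝒟-coeff F n i j = trans (𝒟-by-shifts n i j) (cong (λ s → Dz F n i j - s) (
  cong₂ _-_ (cong₂ _+_ (cong₂ _-_ (cong₂ _+_
    (trans (Y⊛-coeff (Z ⊛ Dz F) n i j) (shift-cong (Z⊛Dz-coeff F n i) j))
    (Y⊛-coeff (Dx F) n i j))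
    (trans (Y⊛-coeff (X ⊛ Dx F) n i j) (shift-cong (X⊛Dx-coeff F n i) j)))
    (Y⊛Dy-coeff F n i j))
    (trans (cst-⊛ (fromℕ 2) (Y ⊛ (Y ⊛ Dy F)) n i j)
           (cong (fromℕ 2 *_) (trans (Y⊛-coeff (Y ⊛ Dy F) n i j) (shift-cong (Y⊛Dy-coeff F n i) j))))))
  where
  𝒟-by-shifts : 𝒟 F ≈ Dz F ⊖ (Y ⊛ (Z ⊛ Dz F) ⊕ Y ⊛ Dx F ⊖ Y ⊛ (X ⊛ Dx F) ⊕ Y ⊛ Dy F
                               ⊖ cst (fromℕ 2) ⊛ (Y ⊛ (Y ⊛ Dy F)))
  𝒟-by-shifts = solve 6 (λ fz fx fy x y z →
       𝒟-poly x y z fz fx fy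
    := fz :- (y :* (z :* fz) :+ y :* fx :- y :* (x :* fx) :+ y :* fy :- con (fromℕ 2) :* (y :* (y :* fy))))
    ≈-refl (Dz F) (Dx F) (Dy F) X Y Z
    where open 𝒟-Solver

sliceCoeff-zero : ∀ {f} n → (∀ i j → f i j ≡ 0ℚ) → ∀ i j → sliceCoeff f n i j ≡ 0ℚ
sliceCoeff-zero {f} n f≡0 i j =
  cong₂ _-_ (cong₂ _+_ (cong₂ _-_ (cong₂ _+_
    (shift-zero (λ j′ → times0 (fromℕ n) (f≡0 i j′)) j)
    (shift-zero (λ j′ → times0 (fromℕ (suc i)) (f≡0 (suc i) j′)) j))
    (shift-zero (λ j′ → times0 (fromℕ i) (f≡0 i j′)) j))
    (times0 (fromℕ j) (f≡0 i j)))
    (times0 (fromℕ 2) (shift-zero (λ j′ → times0 (fromℕ j′) (f≡0 i j′)) j))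
  where
  times0 : ∀ c {x} → x ≡ 0ℚ → c * x ≡ 0ℚ
  times0 c x≡0 = trans (cong (c *_) x≡0) (ℚP.*-zeroʳ c)

[X-1]⊛-coeff : ∀ F n i j → ((X ⊖ cst 1ℚ) ⊛ F) n i j ≡ shift (λ i′ → F n i′ j) i - F n i j
[X-1]⊛-coeff F n i j =
  trans (distrib n i j) (cong₂ _-_ (X⊛-coeff F n i j) (trans (cst-⊛ 1ℚ F n i j) (ℚP.*-identityˡ (F n i j))))
  where
  distrib : (X ⊖ cst 1ℚ) ⊛ F ≈ X ⊛ F ⊖ cst 1ℚ ⊛ F
  distrib = solve 2 (λ x f → (x :- con 1ℚ) :* f := x :* f :- con 1ℚ :* f) ≈-refl X F
    where open Series-Solver using (solve; _:*_; _:-_; _:=_; con)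

𝒟-solution-vanishes : ∀ {H} → 𝒟 H ≈ (X ⊖ cst 1ℚ) ⊛ H → VanishesAtZ0 H → H ≈ zeroS
𝒟-solution-vanishes {H} 𝒟H H₀≡0 n i j = slice-vanishes n i j
  where
  slice-vanishes : ∀ n i j → H n i j ≡ 0ℚ
  slice-vanishes zero    i j = H₀≡0 i j
  slice-vanishes (suc n) i j = [1+n]*x≡0⇒x≡0 n (H (suc n) i j) (begin
      Dz H n i j
    ≡⟨ solve 2 (λ d s → d := d :- s :+ s) refl (Dz H n i j) (sliceCoeff (H n) n i j) ⟩
      Dz H n i j - sliceCoeff (H n) n i j + sliceCoeff (H n) n i j
    ≡⟨ cong (_+ sliceCoeff (H n) n i j) (sym (𝒟-coeff H n i j)) ⟩
      𝒟 H n i j + sliceCoeff (H n) n i j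
    ≡⟨ cong₂ _+_ (trans (𝒟H n i j) ([X-1]⊛-coeff H n i j)) (sliceCoeff-zero n (slice-vanishes n) i j) ⟩
      shift (λ i′ → H n i′ j) i - H n i j + 0ℚ
    ≡⟨ cong₂ (λ a b → a - b + 0ℚ) (shift-zero (λ i′ → slice-vanishes n i′ j) i) (slice-vanishes n i j) ⟩
      0ℚ
    ∎)
    where
    open ≡-Reasoning
    open ℚ-Solver.+-*-Solver

𝒟-solution-unique : ∀ {F G} → 𝒟 F ≈ (X ⊖ cst 1ℚ) ⊛ F → 𝒟 G ≈ (X ⊖ cst 1ℚ) ⊛ G →
  (∀ i j → F 0 i j ≡ G 0 i j) → F ≈ G
𝒟-solution-unique {F} {G} 𝒟F 𝒟G F₀≡G₀ = begin
    F                 ≈⟨ solve 2 (λ f g → f := (f :- g) :+ g) ≈-refl F G ⟩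
    (F ⊖ G) ⊕ G       ≈⟨ ⊕-cong {F ⊖ G} {zeroS} {G} (𝒟-solution-vanishes 𝒟[F-G] [F-G]₀≡0) ≈-refl ⟩
    zeroS ⊕ G         ≈⟨ (λ n i j → ℚP.+-identityˡ (G n i j)) ⟩
    G                 ∎
  where
  open ≈-Reasoning
  open Series-Solver using (solve; _:+_; _:*_; _:-_; _:=_; con)
  𝒟[F-G] : 𝒟 (F ⊖ G) ≈ (X ⊖ cst 1ℚ) ⊛ (F ⊖ G)
  𝒟[F-G] = begin
      𝒟 (F ⊖ G)
    ≈⟨ 𝒟-⊖ F G ⟩
      𝒟 F ⊖ 𝒟 G
    ≈⟨ ⊖-cong 𝒟F 𝒟G ⟩
      (X ⊖ cst 1ℚ) ⊛ F ⊖ (X ⊖ cst 1ℚ) ⊛ G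
    ≈⟨ solve 3 (λ x f g → (x :- con 1ℚ) :* f :- (x :- con 1ℚ) :* g := (x :- con 1ℚ) :* (f :- g)) ≈-refl X F G ⟩
      (X ⊖ cst 1ℚ) ⊛ (F ⊖ G)
    ∎
  [F-G]₀≡0 : VanishesAtZ0 (F ⊖ G)
  [F-G]₀≡0 i j = trans (cong (_- G 0 i j) (F₀≡G₀ i j)) (ℚP.+-inverseʳ (G 0 i j))

-- The exponential generating function of γ

γℚ : ℕ → ℕ → ℕ → ℚ
γℚ n i j = ι (γ n i j)

Γ : Series
Γ n i j = γℚ n i j * invFact n

-- The coefficient n - i - 2(j + 1) + 2 of γ n i j in the recurrence for γ (n + 1) i (j + 1).
coefficient : ℕ → ℕ → ℕ → ℤ
coefficient n i j = ℤ.+ n ℤ.- ℤ.+ i ℤ.- ℤ.+ (2 ℕ.* suc j) ℤ.+ ℤ.+ 2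

ι-coefficient : ∀ n i j → ι (coefficient n i j) ≡ fromℕ n - fromℕ i - fromℕ 2 * fromℕ j
ι-coefficient n i j = begin
    ι (ℤ.+ n ℤ.- ℤ.+ i ℤ.- ℤ.+ (2 ℕ.* suc j) ℤ.+ ℤ.+ 2)
  ≡⟨ cong (λ t → ι (ℤ.+ n ℤ.- ℤ.+ i ℤ.- t ℤ.+ ℤ.+ 2))
          (trans (ℤP.pos-* 2 (suc j)) (cong (ℤ.+ 2 ℤ.*_) (ℤP.pos-+ 1 j))) ⟩
    ι (ℤ.+ n ℤ.- ℤ.+ i ℤ.- ℤ.+ 2 ℤ.* (ℤ.+ 1 ℤ.+ ℤ.+ j) ℤ.+ ℤ.+ 2)
  ≡⟨ cong ι (solve 3 (λ n i j → n :- i :- con (ℤ.+ 2) :* (con (ℤ.+ 1) :+ j) :+ con (ℤ.+ 2)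
                               := n :- i :- con (ℤ.+ 2) :* j) refl (ℤ.+ n) (ℤ.+ i) (ℤ.+ j)) ⟩
    ι (ℤ.+ n ℤ.- ℤ.+ i ℤ.- ℤ.+ 2 ℤ.* ℤ.+ j)
  ≡⟨ trans (ι-- (ℤ.+ n ℤ.- ℤ.+ i) (ℤ.+ 2 ℤ.* ℤ.+ j))
           (cong₂ _-_ (ι-- (ℤ.+ n) (ℤ.+ i)) (ι-* (ℤ.+ 2) (ℤ.+ j))) ⟩
    fromℕ n - fromℕ i - fromℕ 2 * fromℕ j
  ∎
  where
  open ≡-Reasoning
  open ℤ-Solver.+-*-Solver

private
  ι-sum₄ : ∀ a b c d {a′ b′ c′ d′} → ι a ≡ a′ → ι b ≡ b′ → ι c ≡ c′ → ι d ≡ d′ →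
    ι (a ℤ.+ b ℤ.+ c ℤ.+ d) ≡ a′ + b′ + c′ + d′
  ι-sum₄ a b c d ιa ιb ιc ιd =
    trans (ι-+ (a ℤ.+ b ℤ.+ c) d) (cong₂ _+_ (trans (ι-+ (a ℤ.+ b) c)
      (cong₂ _+_ (trans (ι-+ a b) (cong₂ _+_ ιa ιb)) ιc)) ιd)

-- The right-hand side of the recurrence for γ (n + 1) i j in terms of g = γ n, where shift
-- supplies the terms with a negative index.
recurrence : (ℕ → ℕ → ℚ) → ℕ → ℕ → ℕ → ℚ
recurrence g n i j =
    shift (λ i′ → g i′ j) i + shift (λ j′ → fromℕ (suc i) * g (suc i) j′) j + fromℕ j * g i j
  + shift (λ j′ → (fromℕ n - fromℕ i - fromℕ 2 * fromℕ j′) * g i j′) j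

γℚ-recurrence : ∀ n i j → γℚ (suc n) i j ≡ recurrence (γℚ n) n i j
γℚ-recurrence n zero zero =
  ι-sum₄ (ℤ.+ 0) (ℤ.+ 0) (ℤ.+ 0 ℤ.* γ n 0 0) (ℤ.+ 0) refl refl (ι-* (ℤ.+ 0) (γ n 0 0)) refl
γℚ-recurrence n (suc i) zero =
  ι-sum₄ (γ n i 0) (ℤ.+ 0) (ℤ.+ 0 ℤ.* γ n (suc i) 0) (ℤ.+ 0) refl refl (ι-* (ℤ.+ 0) (γ n (suc i) 0)) refl
γℚ-recurrence n zero (suc j) =
  ι-sum₄ (ℤ.+ 0) (ℤ.+ 1 ℤ.* γ n 1 j) (ℤ.+ suc j ℤ.* γ n 0 (suc j)) (coefficient n 0 j ℤ.* γ n 0 j)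
    refl (ι-* (ℤ.+ 1) (γ n 1 j)) (ι-* (ℤ.+ suc j) (γ n 0 (suc j)))
    (trans (ι-* (coefficient n 0 j) (γ n 0 j)) (cong (_* γℚ n 0 j) (ι-coefficient n 0 j)))
γℚ-recurrence n (suc i) (suc j) =
  ι-sum₄ (γ n i (suc j)) (ℤ.+ suc (suc i) ℤ.* γ n (suc (suc i)) j) (ℤ.+ suc j ℤ.* γ n (suc i) (suc j))
    (coefficient n (suc i) j ℤ.* γ n (suc i) j)
    refl (ι-* (ℤ.+ suc (suc i)) (γ n (suc (suc i)) j)) (ι-* (ℤ.+ suc j) (γ n (suc i) (suc j)))
    (trans (ι-* (coefficient n (suc i) j) (γ n (suc i) j)) (cong (_* γℚ n (suc i) j) (ι-coefficient n (suc i) j)))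

Dz-Γ : ∀ n i j → Dz Γ n i j ≡ γℚ (suc n) i j * invFact n
Dz-Γ n i j = begin
    fromℕ (suc n) * (γℚ (suc n) i j * invFact (suc n))
  ≡⟨ *-pull (fromℕ (suc n)) (γℚ (suc n) i j) (invFact (suc n)) ⟩
    γℚ (suc n) i j * (fromℕ (suc n) * invFact (suc n))
  ≡⟨ cong (γℚ (suc n) i j *_) (invFact-suc n) ⟩
    γℚ (suc n) i j * invFact n
  ∎
  where open ≡-Reasoning

𝒟-Γ : 𝒟 Γ ≈ X ⊛ Γ
𝒟-Γ n i j = begin
    𝒟 Γ n i j
  ≡⟨ 𝒟-coeff Γ n i j ⟩
    Dz Γ n i j - sliceCoeff (Γ n) n i j
  ≡⟨ cong (_- sliceCoeff (Γ n) n i j) (trans (Dz-Γ n i j) (cong (_* invFact n) (γℚ-recurrence n i j))) ⟩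
    recurrence (γℚ n) n i j * invFact n - sliceCoeff (Γ n) n i j
  ≡⟨ slice-cancels j ⟩
    shift (λ i′ → γℚ n i′ j) i * invFact n
  ≡⟨ shift-*ʳ (λ i′ → γℚ n i′ j) (invFact n) i ⟩
    shift (λ i′ → Γ n i′ j) i
  ≡⟨ sym (X⊛-coeff Γ n i j) ⟩
    (X ⊛ Γ) n i j
  ∎
  where
  open ≡-Reasoning
  open ℚ-Solver.+-*-Solver
  slice-cancels : ∀ j → recurrence (γℚ n) n i j * invFact n - sliceCoeff (Γ n) n i j
                       ≡ shift (λ i′ → γℚ n i′ j) i * invFact n
  slice-cancels zero = solve 3 (λ s g e →
       (s :+ con 0ℚ :+ con 0ℚ :* g :+ con 0ℚ) :* e
         :- (con 0ℚ :+ con 0ℚ :- con 0ℚ :+ con 0ℚ :* (g :* e) :- con (fromℕ 2) :* con 0ℚ)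
    := s :* e) refl (shift (λ i′ → γℚ n i′ 0) i) (γℚ n i 0) (invFact n)
  slice-cancels (suc j) = solve 10 (λ s m k k′ l l′ g₁ g₂ g₃ e →
       (s :+ k′ :* g₁ :+ l′ :* g₂ :+ (m :- k :- con (fromℕ 2) :* l) :* g₃) :* e
         :- (m :* (g₃ :* e) :+ k′ :* (g₁ :* e) :- k :* (g₃ :* e) :+ l′ :* (g₂ :* e)
             :- con (fromℕ 2) :* (l :* (g₃ :* e)))
    := s :* e) refl (shift (λ i′ → γℚ n i′ (suc j)) i) (fromℕ n) (fromℕ i) (fromℕ (suc i))
         (fromℕ j) (fromℕ (suc j))
         (γℚ n (suc i) j) (γℚ n i (suc j)) (γℚ n i j) (invFact n)

private
  i+2[1+j]≡2+i+2j : ∀ i j → i ℕ.+ 2 ℕ.* suc j ≡ suc (suc (i ℕ.+ 2 ℕ.* j))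
  i+2[1+j]≡2+i+2j i j = trans (cong (i ℕ.+_) (ℕP.*-suc 2 j)) (trans (ℕP.+-suc i _) (cong suc (ℕP.+-suc i _)))

  coefficient-vanishes : ∀ i j → coefficient (i ℕ.+ 2 ℕ.* j) i j ≡ ℤ.0ℤ
  coefficient-vanishes i j =
    trans (cong₂ (λ a b → a ℤ.- ℤ.+ i ℤ.- b ℤ.+ ℤ.+ 2) (ℤP.pos-+ i (2 ℕ.* j))
                 (trans (cong ℤ.+_ (ℕP.*-suc 2 j)) (ℤP.pos-+ 2 (2 ℕ.* j))))
          (solve 2 (λ a b → (a :+ b) :- a :- (con (ℤ.+ 2) :+ b) :+ con (ℤ.+ 2) := con ℤ.0ℤ) refl
                 (ℤ.+ i) (ℤ.+ (2 ℕ.* j)))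
    where open ℤ-Solver.+-*-Solver

  sum₄-vanishes : ∀ a b c d → a ≡ ℤ.0ℤ → b ≡ ℤ.0ℤ → c ≡ ℤ.0ℤ → d ≡ ℤ.0ℤ →
                  a ℤ.+ b ℤ.+ c ℤ.+ d ≡ ℤ.0ℤ
  sum₄-vanishes _ _ _ _ refl refl refl refl = refl

  module RecurrenceTermsVanish n (IH : ∀ i j → n < i ℕ.+ 2 ℕ.* j → γ n i j ≡ ℤ.0ℤ) where
    n≤i+2j : ∀ {i j} → suc n < i ℕ.+ 2 ℕ.* suc j → n ≤ i ℕ.+ 2 ℕ.* j
    n≤i+2j {i} {j} h = ℕP.≤-pred (ℕP.≤-pred (≡.subst (suc (suc n) ≤_) (i+2[1+j]≡2+i+2j i j) h))

    term₂-vanishes : ∀ i j → suc n < i ℕ.+ 2 ℕ.* suc j → ℤ.+ suc i ℤ.* γ n (suc i) j ≡ ℤ.0ℤ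
    term₂-vanishes i j h = trans (cong (ℤ.+ suc i ℤ.*_) (IH (suc i) j (s≤s (n≤i+2j h)))) (ℤP.*-zeroʳ (ℤ.+ suc i))

    term₃-vanishes : ∀ i j → suc n < i ℕ.+ 2 ℕ.* j → ℤ.+ j ℤ.* γ n i j ≡ ℤ.0ℤ
    term₃-vanishes i j h = trans (cong (ℤ.+ j ℤ.*_) (IH i j (ℕP.<-trans (ℕP.n<1+n n) h))) (ℤP.*-zeroʳ (ℤ.+ j))

    -- At the boundary n = i + 2j the term survives in γ n i j but its coefficient is 0.
    term₄-vanishes : ∀ i j → suc n < i ℕ.+ 2 ℕ.* suc j → coefficient n i j ℤ.* γ n i j ≡ ℤ.0ℤ
    term₄-vanishes i j h with ℕP.m≤n⇒m<n∨m≡n (n≤i+2j h)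
    ... | inj₁ n<i+2j = trans (cong (coefficient n i j ℤ.*_) (IH i j n<i+2j)) (ℤP.*-zeroʳ (coefficient n i j))
    ... | inj₂ refl   = trans (cong (ℤ._* γ n i j) (coefficient-vanishes i j)) (ℤP.*-zeroˡ (γ n i j))

γ-vanishes : ∀ n i j → n < i ℕ.+ 2 ℕ.* j → γ n i j ≡ ℤ.0ℤ
γ-vanishes zero    zero    zero    ()
γ-vanishes zero    zero    (suc j) _ = refl
γ-vanishes zero    (suc i) j       _ = refl
γ-vanishes (suc n) zero    zero    ()
γ-vanishes (suc n) (suc i) zero    h =
  sum₄-vanishes (γ n i 0) (ℤ.+ 0) (ℤ.+ 0 ℤ.* γ n (suc i) 0) (ℤ.+ 0)
    (γ-vanishes n i 0 (ℕP.≤-pred h)) refl (ℤP.*-zeroˡ (γ n (suc i) 0)) refl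
γ-vanishes (suc n) zero    (suc j) h =
  sum₄-vanishes (ℤ.+ 0) (ℤ.+ 1 ℤ.* γ n 1 j) (ℤ.+ suc j ℤ.* γ n 0 (suc j)) (coefficient n 0 j ℤ.* γ n 0 j)
    refl (term₂-vanishes 0 j h) (term₃-vanishes 0 (suc j) h) (term₄-vanishes 0 j h)
  where open RecurrenceTermsVanish n (γ-vanishes n)
γ-vanishes (suc n) (suc i) (suc j) h =
  sum₄-vanishes (γ n i (suc j)) (ℤ.+ suc (suc i) ℤ.* γ n (suc (suc i)) j)
    (ℤ.+ suc j ℤ.* γ n (suc i) (suc j)) (coefficient n (suc i) j ℤ.* γ n (suc i) j)
    (γ-vanishes n i (suc j) (ℕP.≤-pred h)) (term₂-vanishes (suc i) j h) (term₃-vanishes (suc i) (suc j) h)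
    (term₄-vanishes (suc i) j h)
  where open RecurrenceTermsVanish n (γ-vanishes n)

Γ-vanishes : ∀ n i j → n < i ℕ.+ 2 ℕ.* j → Γ n i j ≡ 0ℚ
Γ-vanishes n i j n<i+2j = trans (cong (λ z → ι z * invFact n) (γ-vanishes n i j n<i+2j)) (ℚP.*-zeroˡ (invFact n))

gammaGF≡Γ : ∀ n i j → gammaGF n i j ≡ Γ n i j
gammaGF≡Γ n i j with i ≤ᵇ n | ℕP.≤ᵇ-reflects-≤ i n
... | false | ofⁿ i≰n =
  sym (Γ-vanishes n i j (ℕP.<-≤-trans (ℕP.≰⇒> i≰n) (ℕP.m≤m+n i (2 ℕ.* j))))
... | true  | ofʸ i≤n with 2 ℕ.* j ≤ᵇ n ∸ i | ℕP.≤ᵇ-reflects-≤ (2 ℕ.* j) (n ∸ i)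
...   | false | ofⁿ 2j≰n∸i =
  sym (Γ-vanishes n i j (≡.subst (_< i ℕ.+ 2 ℕ.* j) (ℕP.m+[n∸m]≡n i≤n) (ℕP.+-monoʳ-< i (ℕP.≰⇒> 2j≰n∸i))))
...   | true  | ofʸ _ = refl

-- The trigonometric factor

½ ¼ : ℚ
½ = 1ℚ ℚ.÷ fromℕ 2
¼ = 1ℚ ℚ.÷ fromℕ 4

-- cosW = C(w²) and sinWoverA = (z/2) S(w²) for C(t) = cos √t and S(t) = sin √t / √t.
cosCoeff sincCoeff : ℕ → ℚ
cosCoeff  k = sign k * invFact (2 ℕ.* k)
sincCoeff k = sign k * invFact (suc (2 ℕ.* k))

private
  fromℕ-2[1+k] : ∀ k → fromℕ (suc (suc (2 ℕ.* k))) ≡ fromℕ 2 * fromℕ (suc k)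
  fromℕ-2[1+k] k = trans (cong fromℕ (sym (ℕP.*-suc 2 k))) (fromℕ-* 2 (suc k))

derivative-cosCoeff : ∀ k → derivative cosCoeff k ≡ (- ½) * sincCoeff k
derivative-cosCoeff k = begin
    fromℕ (suc k) * (- sign k * invFact (2 ℕ.* suc k))
  ≡⟨ cong₂ (λ a b → a * (- sign k * invFact b)) [1+k]≡½[2+2k] (ℕP.*-suc 2 k) ⟩
    (½ * N) * (- sign k * invFact (suc (suc (2 ℕ.* k))))
  ≡⟨ solve 4 (λ h n s i → (h :* n) :* (:- s :* i) := (:- h) :* (s :* (n :* i))) refl
       ½ N (sign k) (invFact (suc (suc (2 ℕ.* k)))) ⟩
    (- ½) * (sign k * (N * invFact (suc (suc (2 ℕ.* k)))))
  ≡⟨ cong (λ t → (- ½) * (sign k * t)) (invFact-suc (suc (2 ℕ.* k))) ⟩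
    (- ½) * sincCoeff k
  ∎
  where
  open ≡-Reasoning
  open ℚ-Solver.+-*-Solver
  N : ℚ
  N = fromℕ (suc (suc (2 ℕ.* k)))
  [1+k]≡½[2+2k] : fromℕ (suc k) ≡ ½ * N
  [1+k]≡½[2+2k] = sym (trans (cong (½ *_) (fromℕ-2[1+k] k))
    (trans (sym (ℚP.*-assoc ½ (fromℕ 2) (fromℕ (suc k)))) (ℚP.*-identityˡ (fromℕ (suc k)))))

-- C(t) = S(t) + 2 t S′(t), the power series form of cos w = d(w S(w²))/dw.
cosCoeff-via-sincCoeff : ∀ k → sincCoeff k + fromℕ 2 * shift (derivative sincCoeff) k ≡ cosCoeff k
cosCoeff-via-sincCoeff zero    = refl
cosCoeff-via-sincCoeff (suc k) = begin
    sincCoeff (suc k) + fromℕ 2 * (fromℕ (suc k) * sincCoeff (suc k))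
  ≡⟨ solve 3 (λ a t f → a :+ t :* (f :* a) := (con 1ℚ :+ t :* f) :* a) refl
       (sincCoeff (suc k)) (fromℕ 2) (fromℕ (suc k)) ⟩
    (1ℚ + fromℕ 2 * fromℕ (suc k)) * sincCoeff (suc k)
  ≡⟨ cong (_* sincCoeff (suc k)) (sym (trans (fromℕ-+ 1 (suc (suc (2 ℕ.* k)))) (cong (1ℚ +_) (fromℕ-2[1+k] k)))) ⟩
    N * (- sign k * invFact (suc (2 ℕ.* suc k)))
  ≡⟨ cong (λ b → N * (- sign k * invFact (suc b))) (ℕP.*-suc 2 k) ⟩
    N * (- sign k * invFact (suc (suc (suc (2 ℕ.* k)))))
  ≡⟨ solve 3 (λ n s i → n :* (s :* i) := s :* (n :* i)) refl N (- sign k) (invFact (suc (suc (suc (2 ℕ.* k))))) ⟩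
    - sign k * (N * invFact (suc (suc (suc (2 ℕ.* k)))))
  ≡⟨ cong (λ t → - sign k * t) (trans (invFact-suc (suc (suc (2 ℕ.* k)))) (cong invFact (sym (ℕP.*-suc 2 k)))) ⟩
    cosCoeff (suc k)
  ∎
  where
  open ≡-Reasoning
  open ℚ-Solver.+-*-Solver
  N : ℚ
  N = fromℕ (suc (suc (suc (2 ℕ.* k))))

σ τ : Series
σ = subst sincCoeff w²
τ = subst (derivative sincCoeff) w²

Q : Series
Q = cosW ⊖ sinWoverA

u : Series
u = cst (fromℕ 2) ⊛ Y ⊖ cst 1ℚ

w²-poly : w² ≈ cst ¼ ⊛ (Z ⊛ Z ⊛ u)
w²-poly = ≈-trans (scale≈cst⊛ ¼ (Z ⊛ Z ⊛ (scale (fromℕ 2) Y ⊖ one)))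
  (⊛-cong {cst ¼} ≈-refl (⊛-cong {Z ⊛ Z} ≈-refl (⊖-cong (scale≈cst⊛ (fromℕ 2) Y) (≈-sym cst1))))

w²-vanishes : VanishesAtZ0 w²
w²-vanishes = VanishesAtZ0-scale ¼ {Z ⊛ Z ⊛ (scale (fromℕ 2) Y ⊖ one)}
  (VanishesAtZ0-⊛ {Z ⊛ Z} (scale (fromℕ 2) Y ⊖ one) (VanishesAtZ0-⊛ {Z} Z (λ _ _ → refl)))

cosW-via-σ : cosW ≈ σ ⊕ cst (fromℕ 2) ⊛ (w² ⊛ τ)
cosW-via-σ = begin
    subst cosCoeff w²
  ≈⟨ subst-cong w² (λ k → sym (cosCoeff-via-sincCoeff k)) ⟩
    subst (λ k → sincCoeff k + fromℕ 2 * shift (derivative sincCoeff) k) w²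
  ≈⟨ subst-+ sincCoeff (λ k → fromℕ 2 * shift (derivative sincCoeff) k) w² ⟩
    σ ⊕ subst (λ k → fromℕ 2 * shift (derivative sincCoeff) k) w²
  ≈⟨ ⊕-cong {σ} ≈-refl (≈-trans (subst-scale (fromℕ 2) (shift (derivative sincCoeff)) w²)
                                (scale≈cst⊛ (fromℕ 2) (subst (shift (derivative sincCoeff)) w²))) ⟩
    σ ⊕ cst (fromℕ 2) ⊛ subst (shift (derivative sincCoeff)) w²
  ≈⟨ ⊕-cong {σ} ≈-refl (⊛-cong {cst (fromℕ 2)} ≈-refl (≈-sym (subst-shift w²-vanishes (derivative sincCoeff)))) ⟩
    σ ⊕ cst (fromℕ 2) ⊛ (w² ⊛ τ)
  ∎
  where open ≈-Reasoning

Q-poly : Q ≈ σ ⊕ cst (fromℕ 2) ⊛ (cst ¼ ⊛ (Z ⊛ Z ⊛ u) ⊛ τ) ⊖ cst ½ ⊛ Z ⊛ σ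
Q-poly = ⊖-cong
  (≈-trans cosW-via-σ (⊕-cong {σ} ≈-refl (⊛-cong {cst (fromℕ 2)} ≈-refl (⊛-cong {G = τ} w²-poly ≈-refl))))
  (⊛-cong {G = σ} (scale≈cst⊛ ½ Z) ≈-refl)

sinWoverA-vanishes : VanishesAtZ0 sinWoverA
sinWoverA-vanishes = VanishesAtZ0-⊛ {scale ½ Z} σ (VanishesAtZ0-scale ½ {Z} (λ _ _ → refl))

-- Dz, Dx and Dy differ on Q and e^{z(x-1)} only through their values on x, y, z, so those
-- derivatives are computed once for a derivation taking constant values ∂x, ∂y, ∂z there.
module ConstantCoefficientDerivation {D : Series → Series} (isD : IsDerivation D) (∂x ∂y ∂z : ℚ)
  (D-X : D X ≈ cst ∂x) (D-Y : D Y ≈ cst ∂y) (D-Z : D Z ≈ cst ∂z) where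
  open DerivationRules isD
  open ≈-Reasoning

  D-u : D u ≈ cst (fromℕ 2) ⊛ cst ∂y
  D-u = begin
      D (cst (fromℕ 2) ⊛ Y ⊖ cst 1ℚ)
    ≈⟨ d-⊖ (cst (fromℕ 2) ⊛ Y) (cst 1ℚ) ⟩
      D (cst (fromℕ 2) ⊛ Y) ⊖ D (cst 1ℚ)
    ≈⟨ ⊖-cong (≈-trans (d-cst⊛ (fromℕ 2) Y) (⊛-cong {cst (fromℕ 2)} ≈-refl D-Y)) (d-cst 1ℚ) ⟩
      cst (fromℕ 2) ⊛ cst ∂y ⊖ cst 0ℚ
    ≈⟨ solve 1 (λ d → con (fromℕ 2) :* d :- con 0ℚ := con (fromℕ 2) :* d) ≈-refl (cst ∂y) ⟩
      cst (fromℕ 2) ⊛ cst ∂y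
    ∎
    where open Series-Solver using (solve; _:*_; _:-_; _:=_; con)

  Dw² : Series
  Dw² = cst ½ ⊛ (cst ∂z ⊛ Z ⊛ u ⊕ cst ∂y ⊛ Z ⊛ Z)

  D-w² : D w² ≈ Dw²
  D-w² = begin
      D w²
    ≈⟨ ≈-trans (d-cong w²-poly) (d-cst⊛ ¼ (Z ⊛ Z ⊛ u)) ⟩
      cst ¼ ⊛ D (Z ⊛ Z ⊛ u)
    ≈⟨ ⊛-cong {cst ¼} ≈-refl (≈-trans (d-leibniz (Z ⊛ Z) u) (⊕-cong {G = Z ⊛ Z ⊛ D u}
         (⊛-cong {G = u} (≈-trans (d-leibniz Z Z) (⊕-cong (⊛-cong {G = Z} D-Z ≈-refl) (⊛-cong {Z} ≈-refl D-Z))) ≈-refl)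
         (⊛-cong {Z ⊛ Z} ≈-refl D-u))) ⟩
      cst ¼ ⊛ ((cst ∂z ⊛ Z ⊕ Z ⊛ cst ∂z) ⊛ u ⊕ Z ⊛ Z ⊛ (cst (fromℕ 2) ⊛ cst ∂y))
    ≈⟨ solve 4 (λ dy dz z v →
            con ¼ :* ((dz :* z :+ z :* dz) :* v :+ z :* z :* (con (fromℕ 2) :* dy))
         := con ½ :* (dz :* z :* v :+ dy :* z :* z)) ≈-refl (cst ∂y) (cst ∂z) Z u ⟩
      Dw²
    ∎
    where open Series-Solver using (solve; _:+_; _:*_; _:=_; con)

  D-Q : D Q ≈ cst (- ½) ⊛ σ ⊛ Dw² ⊖ (cst ½ ⊛ cst ∂z ⊛ σ ⊕ cst ½ ⊛ Z ⊛ (τ ⊛ Dw²))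
  D-Q = ≈-trans (d-⊖ cosW sinWoverA) (⊖-cong D-cosW D-sinWoverA)
    where
    D-σ : D σ ≈ τ ⊛ Dw²
    D-σ = ≈-trans (chain-rule w²-vanishes sincCoeff) (⊛-cong {τ} ≈-refl D-w²)
    D-cosW : D cosW ≈ cst (- ½) ⊛ σ ⊛ Dw²
    D-cosW = ≈-trans (chain-rule w²-vanishes cosCoeff) (⊛-cong
      (≈-trans (subst-cong w² derivative-cosCoeff) (≈-trans (subst-scale (- ½) sincCoeff w²) (scale≈cst⊛ (- ½) σ)))
      D-w²)
    D-sinWoverA : D sinWoverA ≈ cst ½ ⊛ cst ∂z ⊛ σ ⊕ cst ½ ⊛ Z ⊛ (τ ⊛ Dw²)
    D-sinWoverA = ≈-trans (d-leibniz (scale ½ Z) σ) (⊕-cong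
      (⊛-cong {G = σ} (≈-trans (d-scale ½ Z) (≈-trans (scale≈cst⊛ ½ (D Z)) (⊛-cong {cst ½} ≈-refl D-Z))) ≈-refl)
      (⊛-cong (scale≈cst⊛ ½ Z) D-σ))

  D-expZX : D expZX ≈ expZX ⊛ (cst ∂z ⊛ (X ⊖ cst 1ℚ) ⊕ Z ⊛ cst ∂x)
  D-expZX = ≈-trans (chain-rule (VanishesAtZ0-⊛ {Z} (X ⊖ one) (λ _ _ → refl)) invFact)
    (⊛-cong (subst-cong (Z ⊛ (X ⊖ one)) invFact-suc) D-exponent)
    where
    D-exponent : D (Z ⊛ (X ⊖ one)) ≈ cst ∂z ⊛ (X ⊖ cst 1ℚ) ⊕ Z ⊛ cst ∂x
    D-exponent = begin
        D (Z ⊛ (X ⊖ one))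
      ≈⟨ d-leibniz Z (X ⊖ one) ⟩
        D Z ⊛ (X ⊖ one) ⊕ Z ⊛ D (X ⊖ one)
      ≈⟨ ⊕-cong (⊛-cong D-Z (⊖-cong {X} ≈-refl (≈-sym cst1)))
                (⊛-cong {Z} ≈-refl (≈-trans (d-⊖ X one) (⊖-cong D-X (≈-trans d-one (≈-sym cst0))))) ⟩
        cst ∂z ⊛ (X ⊖ cst 1ℚ) ⊕ Z ⊛ (cst ∂x ⊖ cst 0ℚ)
      ≈⟨ solve 4 (λ dx dz x z → dz :* (x :- con 1ℚ) :+ z :* (dx :- con 0ℚ) := dz :* (x :- con 1ℚ) :+ z :* dx)
           ≈-refl (cst ∂x) (cst ∂z) X Z ⟩
        cst ∂z ⊛ (X ⊖ cst 1ℚ) ⊕ Z ⊛ cst ∂x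
      ∎
      where open Series-Solver using (solve; _:+_; _:*_; _:-_; _:=_; con)

private
  module ∂z = ConstantCoefficientDerivation Dz-isDerivation 0ℚ 0ℚ 1ℚ Dz-X Dz-Y Dz-Z
  module ∂x = ConstantCoefficientDerivation Dx-isDerivation 1ℚ 0ℚ 0ℚ Dx-X Dx-Y Dx-Z
  module ∂y = ConstantCoefficientDerivation Dy-isDerivation 0ℚ 1ℚ 0ℚ Dy-X Dy-Y Dy-Z

𝒟-Q : 𝒟 Q ≈ cst (- ½) ⊛ Q
𝒟-Q = begin
    𝒟 Q
  ≈⟨ 𝒟-fromPartials-cong ∂z.D-Q ∂x.D-Q ∂y.D-Q ⟩
    𝒟-fromPartials (DQ 0ℚ 1ℚ) (DQ 0ℚ 0ℚ) (DQ 1ℚ 0ℚ)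
  ≈⟨ solve 5 (λ s t x y z →
       let v   = con (fromℕ 2) :* y :- con 1ℚ
           DQ′ = λ ∂y ∂z → let Dw²′ = con ½ :* (con ∂z :* z :* v :+ con ∂y :* z :* z) in
                   con (- ½) :* s :* Dw²′ :- (con ½ :* con ∂z :* s :+ con ½ :* z :* (t :* Dw²′))
       in 𝒟-poly x y z (DQ′ 0ℚ 1ℚ) (DQ′ 0ℚ 0ℚ) (DQ′ 1ℚ 0ℚ)
          := con (- ½) :* (s :+ con (fromℕ 2) :* (con ¼ :* (z :* z :* v) :* t) :- con ½ :* z :* s))
       ≈-refl σ τ X Y Z ⟩
    cst (- ½) ⊛ (σ ⊕ cst (fromℕ 2) ⊛ (cst ¼ ⊛ (Z ⊛ Z ⊛ u) ⊛ τ) ⊖ cst ½ ⊛ Z ⊛ σ)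
  ≈⟨ ⊛-cong {cst (- ½)} ≈-refl (≈-sym Q-poly) ⟩
    cst (- ½) ⊛ Q
  ∎
  where
  open ≈-Reasoning
  open 𝒟-Solver
  DQ : ℚ → ℚ → Series
  DQ ∂y ∂z = let Dw² = cst ½ ⊛ (cst ∂z ⊛ Z ⊛ u ⊕ cst ∂y ⊛ Z ⊛ Z) in
    cst (- ½) ⊛ σ ⊛ Dw² ⊖ (cst ½ ⊛ cst ∂z ⊛ σ ⊕ cst ½ ⊛ Z ⊛ (τ ⊛ Dw²))

𝒟-expZX : 𝒟 expZX ≈ (X ⊖ cst 1ℚ) ⊛ expZX
𝒟-expZX = ≈-trans (𝒟-fromPartials-cong ∂z.D-expZX ∂x.D-expZX ∂y.D-expZX)
  (solve 4 (λ e x y z →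
       let DE = λ ∂x ∂z → e :* (con ∂z :* (x :- con 1ℚ) :+ z :* con ∂x) in
       𝒟-poly x y z (DE 0ℚ 1ℚ) (DE 1ℚ 0ℚ) (DE 0ℚ 0ℚ) := (x :- con 1ℚ) :* e)
    ≈-refl expZX X Y Z)
  where open 𝒟-Solver

𝒟-⊛-eigen : ∀ F G A B → 𝒟 F ≈ A ⊛ F → 𝒟 G ≈ B ⊛ G → 𝒟 (F ⊛ G) ≈ (A ⊕ B) ⊛ (F ⊛ G)
𝒟-⊛-eigen F G A B 𝒟F 𝒟G = begin
    𝒟 (F ⊛ G)                  ≈⟨ 𝒟-leibniz F G ⟩
    𝒟 F ⊛ G ⊕ F ⊛ 𝒟 G          ≈⟨ ⊕-cong (⊛-cong {G = G} 𝒟F ≈-refl) (⊛-cong {F} ≈-refl 𝒟G) ⟩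
    A ⊛ F ⊛ G ⊕ F ⊛ (B ⊛ G)    ≈⟨ solve 4 (λ a b f g → a :* f :* g :+ f :* (b :* g) := (a :+ b) :* (f :* g))
                                     ≈-refl A B F G ⟩
    (A ⊕ B) ⊛ (F ⊛ G)          ∎
  where
  open ≈-Reasoning
  open Series-Solver using (solve; _:+_; _:*_; _:=_)

ratio⊛Q≈1 : ratio ⊛ Q ≈ cst 1ℚ
ratio⊛Q≈1 = begin
    secW ⊛ geom tanWoverA ⊛ (cosW ⊖ sinWoverA)
  ≈⟨ solve 4 (λ s g c x → s :* g :* (c :- x) :=
        (s :* c) :* (g :* (con 1ℚ :- x :* s)) :+ (s :* g :* x) :* (s :* c :- con 1ℚ))
      ≈-refl secW (geom tanWoverA) cosW sinWoverA ⟩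
    (secW ⊛ cosW) ⊛ (geom tanWoverA ⊛ (cst 1ℚ ⊖ tanWoverA))
      ⊕ (secW ⊛ geom tanWoverA ⊛ sinWoverA) ⊛ (secW ⊛ cosW ⊖ cst 1ℚ)
  ≈⟨ ⊕-cong (⊛-cong secW⊛cosW≈1 (inverse tanWoverA-vanishes))
            (⊛-cong {secW ⊛ geom tanWoverA ⊛ sinWoverA} ≈-refl (⊖-cong {G = cst 1ℚ} secW⊛cosW≈1 ≈-refl)) ⟩
    cst 1ℚ ⊛ cst 1ℚ ⊕ (secW ⊛ geom tanWoverA ⊛ sinWoverA) ⊛ (cst 1ℚ ⊖ cst 1ℚ)
  ≈⟨ solve 1 (λ a → con 1ℚ :* con 1ℚ :+ a :* (con 1ℚ :- con 1ℚ) := con 1ℚ) ≈-refl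
             (secW ⊛ geom tanWoverA ⊛ sinWoverA) ⟩
    cst 1ℚ
  ∎
  where
  open ≈-Reasoning
  open Series-Solver using (solve; _:+_; _:*_; _:-_; _:=_; con)
  inverse : ∀ {T} → VanishesAtZ0 T → geom T ⊛ (cst 1ℚ ⊖ T) ≈ cst 1ℚ
  inverse {T} T₀≡0 =
    ≈-trans (⊛-cong {geom T} ≈-refl (⊖-cong {G = T} cst1 ≈-refl)) (≈-trans (geom-inverse T₀≡0) (≈-sym cst1))
  tanWoverA-vanishes : VanishesAtZ0 tanWoverA
  tanWoverA-vanishes = VanishesAtZ0-⊛ {sinWoverA} secW sinWoverA-vanishes
  secW⊛cosW≈1 : secW ⊛ cosW ≈ cst 1ℚ
  secW⊛cosW≈1 = begin
      secW ⊛ cosW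
    ≈⟨ solve 2 (λ s c → s :* c := s :* (con 1ℚ :- (con 1ℚ :- c))) ≈-refl secW cosW ⟩
      secW ⊛ (cst 1ℚ ⊖ (cst 1ℚ ⊖ cosW))
    ≈⟨ ⊛-cong {secW} ≈-refl (⊖-cong {cst 1ℚ} ≈-refl (⊖-cong {G = cosW} cst1 ≈-refl)) ⟩
      secW ⊛ (cst 1ℚ ⊖ (one ⊖ cosW))
    ≈⟨ inverse (λ i j → trans (cong (λ c → one 0 i j - c) (ℚP.*-identityˡ (one 0 i j)))
                              (ℚP.+-inverseʳ (one 0 i j))) ⟩
      cst 1ℚ
    ∎

𝒟-ΓQ² : 𝒟 (Γ ⊛ Q ⊛ Q) ≈ (X ⊖ cst 1ℚ) ⊛ (Γ ⊛ Q ⊛ Q)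
𝒟-ΓQ² = begin
    𝒟 (Γ ⊛ Q ⊛ Q)
  ≈⟨ 𝒟-⊛-eigen (Γ ⊛ Q) Q (X ⊕ cst (- ½)) (cst (- ½)) (𝒟-⊛-eigen Γ Q X (cst (- ½)) 𝒟-Γ 𝒟-Q) 𝒟-Q ⟩
    (X ⊕ cst (- ½) ⊕ cst (- ½)) ⊛ (Γ ⊛ Q ⊛ Q)
  ≈⟨ solve 2 (λ x p → (x :+ con (- ½) :+ con (- ½)) :* p := (x :- con 1ℚ) :* p) ≈-refl X (Γ ⊛ Q ⊛ Q) ⟩
    (X ⊖ cst 1ℚ) ⊛ (Γ ⊛ Q ⊛ Q)
  ∎
  where
  open ≈-Reasoning
  open Series-Solver using (solve; _:+_; _:*_; _:-_; _:=_; con)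

ΓQ²-at-z0 : ∀ i j → (Γ ⊛ Q ⊛ Q) 0 i j ≡ expZX 0 i j
ΓQ²-at-z0 i j = begin
    (Γ ⊛ Q ⊛ Q) 0 i j        ≡⟨ ⊛-local 0 {Γ ⊛ Q} {one ⊛ one} (⊛-local 0 Γ₀≡1 Q₀≡1) Q₀≡1 0 z≤n i j ⟩
    (one ⊛ one ⊛ one) 0 i j  ≡⟨ trans (⊛-identityʳ (one ⊛ one) 0 i j) (⊛-identityʳ one 0 i j) ⟩
    one 0 i j                ≡⟨ sym (ℚP.*-identityˡ (one 0 i j)) ⟩
    expZX 0 i j              ∎
  where
  open ≡-Reasoning
  Γ₀≡1 : AgreeUpTo 0 Γ one
  Γ₀≡1 zero _ zero    zero    = refl
  Γ₀≡1 zero _ zero    (suc j) = refl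
  Γ₀≡1 zero _ (suc i) j       = refl
  Q₀≡1 : AgreeUpTo 0 Q one
  Q₀≡1 zero _ i j =
    trans (cong₂ _-_ (ℚP.*-identityˡ (one 0 i j)) (sinWoverA-vanishes i j)) (ℚP.+-identityʳ (one 0 i j))

proposition3p4 : (n i j : ℕ) → gammaGF n i j ≡ rhs n i j
proposition3p4 n i j = trans (gammaGF≡Γ n i j) (Γ≈rhs n i j)
  where
  open ≈-Reasoning
  open Series-Solver using (solve; _:*_; _:=_; con)
  ΓQ²≈expZX : Γ ⊛ Q ⊛ Q ≈ expZX
  ΓQ²≈expZX = 𝒟-solution-unique 𝒟-ΓQ² 𝒟-expZX ΓQ²-at-z0
  Γ≈rhs : Γ ≈ rhs
  Γ≈rhs = begin
    Γ                                  ≈⟨ solve 1 (λ g → g := g :* (con 1ℚ :* con 1ℚ)) ≈-refl Γ ⟩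
    Γ ⊛ (cst 1ℚ ⊛ cst 1ℚ)              ≈⟨ ⊛-cong {Γ} ≈-refl (≈-sym (⊛-cong ratio⊛Q≈1 ratio⊛Q≈1)) ⟩
    Γ ⊛ ((ratio ⊛ Q) ⊛ (ratio ⊛ Q))    ≈⟨ solve 3 (λ g r q → g :* ((r :* q) :* (r :* q)) := (g :* q :* q) :* (r :* r))
                                            ≈-refl Γ ratio Q ⟩
    Γ ⊛ Q ⊛ Q ⊛ (ratio ⊛ ratio)        ≈⟨ ⊛-cong {G = ratio ⊛ ratio} ΓQ²≈expZX ≈-refl ⟩
    rhs                                ∎
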